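{- Let $\overline{II}_n=\sum_{\iota\in\mathcal{I}_n(132)} q^{\mathrm{coinv}(\iota)}$. Then $\overline{II}_0=1$ and for $n\geq 1$, $$\overline{II}_n = q^{n-1}\,\overline{II}_{n-1} + \sum_{k=1}^{\lfloor n/2\rfloor} q^{2(k-1)}C_{k-1}(q^2)\,\overline{II}_{n-2k},$$ where $C_0(q)=1$ and $C_n(q)=\sum_{k=0}^{n-1} q^kC_k(q)C_{n-k-1}(q)$ for $n\geq1$.
   Context: Permutations of $[n]$ are written in one-line notation; $\mathcal{I}_0(132)$ consists of the empty permutation. A permutation $\sigma$ contains a pattern $\pi\in\mathfrak{S}_k$ if some subsequence $\sigma(m_1)\cdots\sigma(m_k)$ with $m_1<\dots<m_k$ is in the same relative order as $\pi$; otherwise it avoids $\pi$. An involution is a permutation $\iota$ with $\iota^2=\mathrm{id}$; $\mathcal{I}_n(\pi)$ is the set of involutions of $[n]$ avoiding $\pi$. A coinversion of $\sigma$ is a pair $i<j$ with $\sigma(i)<\sigma(j)$; $\mathrm{coinv}(\sigma)$ is their number. -}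

module Defs where

open import Level using (Level)
open import Data.Nat as ℕ using (ℕ; zero; suc)
open import Data.Fin using (Fin; toℕ)
open import Data.Fin.Properties using () renaming (_≟_ to _≟F_)
open import Data.Bool using (Bool; true; false; _∧_; if_then_else_)
open import Data.List using (List; []; _∷_; map; concatMap; foldr; filter; length; allFin)
open import Data.Vec using (Vec; []; _∷_; lookup)
open import Relation.Nullary.Decidable using (⌊_⌋)
open import Algebra.Bundles using (CommutativeSemiring)

-- A permutation/function of [n] in one-line notation: the vector (σ(1),…,σ(n)),
-- with [n] represented as Fin n (values 0..n-1).
Word : ℕ → Set
Word n = Vec (Fin n) n

allVecs : (m n : ℕ) → List (Vec (Fin n) m)
allVecs zero    n = [] ∷ []
allVecs (suc m) n = concatMap (λ a → map (a ∷_) (allVecs m n)) (allFin n)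

anyF : ∀ {n} → (Fin n → Bool) → Bool
anyF {n} p = foldr (λ i b → if p i then true else b) false (allFin n)

allF : ∀ {n} → (Fin n → Bool) → Bool
allF {n} p = foldr (λ i b → p i ∧ b) true (allFin n)

_<F_ : ∀ {n} → Fin n → Fin n → Bool
i <F j = ⌊ toℕ i ℕ.<? toℕ j ⌋

-- σ ∘ σ = id  (such a map is automatically a bijection, i.e. an involution)
isInvolution : ∀ {n} → Word n → Bool
isInvolution σ = allF (λ i → ⌊ lookup σ (lookup σ i) ≟F i ⌋)

contains132 : ∀ {n} → Word n → Bool
contains132 σ = anyF λ i → anyF λ j → anyF λ k →
  (i <F j) ∧ (j <F k) ∧ (lookup σ i <F lookup σ k) ∧ (lookup σ k <F lookup σ j)

not : Bool → Bool
not true = false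
not false = true

I132 : (n : ℕ) → List (Word n)
I132 n = filter (λ σ → isInvolution σ ∧ not (contains132 σ) Data.Bool.≟ true) (allVecs n n)

coinv : ∀ {n} → Word n → ℕ
coinv {n} σ = length (filter (λ p → (p .Data.Product.proj₁ <F p .Data.Product.proj₂) ∧ (lookup σ (p .Data.Product.proj₁) <F lookup σ (p .Data.Product.proj₂)) Data.Bool.≟ true)
                        (concatMap (λ i → map (i Data.Product.,_) (allFin n)) (allFin n)))
  where import Data.Product

module _ {c ℓ : Level} (S : CommutativeSemiring c ℓ) where
  open CommutativeSemiring S

  pow : Carrier → ℕ → Carrier
  pow x zero    = 1#
  pow x (suc n) = x * pow x n

  sumS : List Carrier → Carrier
  sumS = foldr _+_ 0#

  IIbar : Carrier → ℕ → Carrier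
  IIbar q n = sumS (map (λ ι → pow q (coinv ι)) (I132 n))

module Submission where

-- Classify ι ∈ I_{n+1}(132) by its last value m = ι(n):
--  * m = n: ι = τ·n for τ ∈ I_n(132), and coinv ι = coinv τ + n;
--  * m < n: ι is the frame (see `frame`) of a unique pair (β, τ) with
--    τ ∈ I_s(132), n = 2m+1+s, and β in B_m, the 132-avoiding involutions of
--    [2m] exchanging their two halves; coinv ι = 2m + coinv β + coinv τ.
-- Applied to B_{j+k+1}, whose members with last value j are the frames of
-- B_j × B_k, the same decomposition shows that the generating function of B_m
-- satisfies the Catalan recurrence in q², hence equals C_m(q²).

open import Defs
open import Level using (Level)
open import Data.Nat using (ℕ; zero; suc; _∸_; _*_; _/_)
import Data.Nat as ℕ
import Data.Nat.Properties as NP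
open import Data.List using (List; []; _∷_; _++_; [_]; map; length; concatMap; cartesianProduct; upTo)
import Data.List.Properties as LP
open import Data.List.Relation.Unary.Any using (here; there)
open import Data.List.Membership.Propositional using (_∈_)
open import Data.List.Membership.Propositional.Properties using (∈-cartesianProduct⁻; ∈-upTo⁻)
open import Data.List.Relation.Unary.Unique.Propositional using (Unique)
import Data.List.Relation.Unary.Unique.Propositional.Properties as UP
open import Data.List.Relation.Binary.Permutation.Propositional as ↭ using (_↭_)
import Data.List.Relation.Binary.Permutation.Propositional.Properties as ↭ₚ
open import Data.Product using (_×_; _,_; proj₁; proj₂)
import Relation.Binary.PropositionalEquality as Eq
open Eq using (_≡_)
open import Algebra.Bundles using (CommutativeSemiring)

-- Everything combinatorial, stated for words represented as lists of naturals:
-- the word w of length n stands for the map i ↦ at w i on {0,…,n-1}.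
module Combinatorics where

  open import Data.Nat
  open import Data.Nat.Properties
  open import Data.Nat.DivMod using (m/n*n≤m; m*n/n≡m; /-monoˡ-≤; m<n*o⇒m/o<n)
  open import Data.Nat.Solver using (module +-*-Solver)
  open +-*-Solver
  open import Data.Bool using (Bool; true; false; _∧_; if_then_else_)
  import Data.Bool
  open import Data.Fin as F using (Fin; toℕ; fromℕ<)
  import Data.Fin.Properties as FP
  open import Data.Vec using (Vec; []; _∷_; lookup)
  import Data.Vec.Properties as VP
  open import Data.List using (List; []; _∷_; _++_; map; length; take; drop; [_]; foldr; filter; allFin; concatMap; tabulate; cartesianProduct; upTo)
  open import Data.List.Properties using (length-++; length-map; length-take; length-drop; take++drop≡id)
  open import Data.List.Relation.Unary.All as All using (All; []; _∷_; all?)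
  open import Data.List.Relation.Unary.All.Properties using (++⁺; map⁺)
  import Data.List.Relation.Unary.All.Properties as AllP
  open import Data.List.Relation.Unary.Any as Any using (Any; here; there)
  open import Data.List.Relation.Unary.AllPairs as AllPairs using (AllPairs; []; _∷_)
  import Data.List.Relation.Unary.AllPairs.Properties as AP
  open import Data.List.Membership.Propositional using (_∈_; lose)
  open import Data.List.Membership.Propositional.Properties
  open import Data.List.Membership.Propositional.Properties.WithK using (unique∧set⇒bag)
  open import Data.List.Relation.Unary.Unique.Propositional using (Unique)
  open import Data.List.Relation.Binary.Permutation.Propositional using (_↭_)
  open import Data.List.Relation.Binary.BagAndSetEquality using (∼bag⇒↭)
  open import Data.Product using (Σ; _×_; _,_; proj₁; proj₂)
  open import Data.Sum using (_⊎_; inj₁; inj₂)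
  open import Data.Empty
  open import Function using (_∘_)
  open import Function.Bundles using (mk⇔)
  open import Relation.Nullary
  open import Relation.Nullary.Decidable using (⌊_⌋; _×-dec_)
  open import Relation.Binary.Definitions using (tri<; tri≈; tri>)
  open import Relation.Binary.PropositionalEquality hiding ([_])

  -- Total indexing (0 outside the list); all statements below only use
  -- indices within range.
  at : List ℕ → ℕ → ℕ
  at [] i = 0
  at (x ∷ xs) zero = x
  at (x ∷ xs) (suc i) = at xs i

  at-++ˡ : ∀ xs ys {n i} → length xs ≡ n → i < n → at (xs ++ ys) i ≡ at xs i
  at-++ˡ (x ∷ xs) ys {i = zero} refl p = refl
  at-++ˡ (x ∷ xs) ys {i = suc i} refl (s≤s p) = at-++ˡ xs ys refl p

  at-++ʳ : ∀ xs ys {n} → length xs ≡ n → ∀ i → at (xs ++ ys) (n + i) ≡ at ys i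
  at-++ʳ [] ys refl i = refl
  at-++ʳ (x ∷ xs) ys refl i = at-++ʳ xs ys refl i

  at-map : ∀ f xs {i} → i < length xs → at (map f xs) i ≡ f (at xs i)
  at-map f (x ∷ xs) {zero} p = refl
  at-map f (x ∷ xs) {suc i} (s≤s p) = at-map f xs p

  at-take : ∀ m xs {i} → i < m → at (take m xs) i ≡ at xs i
  at-take (suc m) [] {i} p = refl
  at-take (suc m) (x ∷ xs) {zero} p = refl
  at-take (suc m) (x ∷ xs) {suc i} (s≤s p) = at-take m xs p

  at-drop : ∀ m xs i → at (drop m xs) i ≡ at xs (m + i)
  at-drop zero xs i = refl
  at-drop (suc m) [] i = refl
  at-drop (suc m) (x ∷ xs) i = at-drop m xs i

  list-ext : ∀ xs ys → length xs ≡ length ys → (∀ i → i < length xs → at xs i ≡ at ys i) → xs ≡ ys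
  list-ext [] [] e f = refl
  list-ext (x ∷ xs) (y ∷ ys) e f =
    cong₂ _∷_ (f zero (s≤s z≤n)) (list-ext xs ys (suc-injective e) (λ i p → f (suc i) (s≤s p)))

  All-at : ∀ {P : ℕ → Set} {xs i} → All P xs → i < length xs → P (at xs i)
  All-at {i = zero} (p ∷ ps) q = p
  All-at {i = suc i} (p ∷ ps) (s≤s q) = All-at ps q

  at-All : ∀ {P : ℕ → Set} xs → (∀ i → i < length xs → P (at xs i)) → All P xs
  at-All [] f = []
  at-All (x ∷ xs) f = f zero (s≤s z≤n) ∷ at-All xs (λ i p → f (suc i) (s≤s p))

  split-idx : ∀ n i → i < n ⊎ Σ ℕ (λ i' → i ≡ n + i')
  split-idx zero i = inj₂ (i , refl)
  split-idx (suc n) zero = inj₁ (s≤s z≤n)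
  split-idx (suc n) (suc i) with split-idx n i
  ... | inj₁ p = inj₁ (s≤s p)
  ... | inj₂ (i' , e) = inj₂ (i' , cong suc e)

  Avoids132 : List ℕ → Set
  Avoids132 l = ∀ {i j k} → i < j → j < k → k < length l → at l i < at l k → at l k < at l j → ⊥

  avoids-++ˡ : ∀ xs ys → Avoids132 (xs ++ ys) → Avoids132 xs
  avoids-++ˡ xs ys av {i} {j} {k} ij jk kl p q =
    av ij jk (≤-trans kl (≤-trans (m≤m+n (length xs) (length ys)) (≤-reflexive (sym (length-++ xs)))))
       (subst₂ _<_ (sym (at-++ˡ xs ys refl (<-trans ij (<-trans jk kl)))) (sym (at-++ˡ xs ys refl kl)) p)
       (subst₂ _<_ (sym (at-++ˡ xs ys refl kl)) (sym (at-++ˡ xs ys refl (<-trans jk kl))) q)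

  avoids-++ʳ : ∀ xs ys → Avoids132 (xs ++ ys) → Avoids132 ys
  avoids-++ʳ xs ys av {i} {j} {k} ij jk kl p q =
    av (+-monoʳ-< (length xs) ij) (+-monoʳ-< (length xs) jk)
       (subst (length xs + k <_) (sym (length-++ xs)) (+-monoʳ-< (length xs) kl))
       (subst₂ _<_ (sym (at-++ʳ xs ys refl i)) (sym (at-++ʳ xs ys refl k)) p)
       (subst₂ _<_ (sym (at-++ʳ xs ys refl k)) (sym (at-++ʳ xs ys refl j)) q)

  -- ... and preserved by concatenating a word lying entirely below another:
  -- a 132 across the cut would need its "3" and "2" in different parts.
  avoids-++-below : ∀ xs ys → (∀ i j → i < length xs → j < length ys → at ys j < at xs i) →
                    Avoids132 xs → Avoids132 ys → Avoids132 (xs ++ ys)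
  avoids-++-below xs ys gt avx avy {i} {j} {k} ij jk kl p q with split-idx (length xs) k
  ... | inj₁ k< = avx ij jk k<
       (subst₂ _<_ (at-++ˡ xs ys refl (<-trans ij (<-trans jk k<))) (at-++ˡ xs ys refl k<) p)
       (subst₂ _<_ (at-++ˡ xs ys refl k<) (at-++ˡ xs ys refl (<-trans jk k<)) q)
  ... | inj₂ (k' , refl) with split-idx (length xs) i
  ...   | inj₁ i< = <-asym p (subst₂ _<_ (sym (at-++ʳ xs ys refl k')) (sym (at-++ˡ xs ys refl i<))
                       (gt i k' i< (+-cancelˡ-< (length xs) _ _ (subst (_ <_) (length-++ xs) kl))))
  ...   | inj₂ (i' , refl) with split-idx (length xs) j
  ...     | inj₁ j< = <-irrefl refl (≤-trans ij (≤-trans (<⇒≤ j<) (m≤m+n _ i')))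
  ...     | inj₂ (j' , refl) =
            avy (+-cancelˡ-< (length xs) _ _ ij) (+-cancelˡ-< (length xs) _ _ jk)
                (+-cancelˡ-< (length xs) _ _ (subst (_ <_) (length-++ xs) kl))
                (subst₂ _<_ (at-++ʳ xs ys refl i') (at-++ʳ xs ys refl k') p)
                (subst₂ _<_ (at-++ʳ xs ys refl k') (at-++ʳ xs ys refl j') q)

  avoids-++-separated : ∀ xs ys c → All (c ≤_) xs → All (_< c) ys → Avoids132 xs → Avoids132 ys → Avoids132 (xs ++ ys)
  avoids-++-separated xs ys c cx cy = avoids-++-below xs ys (λ i j i< j< → <-≤-trans (All-at cy j<) (All-at cx i<))

  -- Appending a new maximum keeps avoidance (it can only play the role of the "3",
  -- which must not be last).
  avoids-snoc-max : ∀ xs x → All (_< x) xs → Avoids132 xs → Avoids132 (xs ++ [ x ])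
  avoids-snoc-max xs x lt av {i} {j} {k} ij jk kl p q with split-idx (length xs) k
  ... | inj₁ k< = av ij jk k<
       (subst₂ _<_ (at-++ˡ xs _ refl (<-trans ij (<-trans jk k<))) (at-++ˡ xs _ refl k<) p)
       (subst₂ _<_ (at-++ˡ xs _ refl k<) (at-++ˡ xs _ refl (<-trans jk k<)) q)
  ... | inj₂ (k' , refl) with split-idx (length xs) j
  ...   | inj₁ j< = <-asym q (subst₂ _<_ (sym (at-++ˡ xs _ refl j<))
                      (sym (trans (at-++ʳ xs _ refl k') (at-singleton k' (+-cancelˡ-< (length xs) _ _ (subst (_ <_) (length-++ xs) kl)))))
                      (All-at lt j<))
    where
    at-singleton : ∀ k' → k' < 1 → at [ x ] k' ≡ x
    at-singleton zero _ = refl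
    at-singleton (suc k') (s≤s ())
  ...   | inj₂ (j' , refl) = no-two-below-one (+-cancelˡ-< (length xs) _ _ jk) (+-cancelˡ-< (length xs) _ _ (subst (_ <_) (length-++ xs) kl))
    where
    no-two-below-one : ∀ {a b} → a < b → b < 1 → ⊥
    no-two-below-one {b = zero} () _
    no-two-below-one {b = suc b} _ (s≤s ())

  -- Avoidance only depends on the relative order of the values.
  avoids-shift : ∀ c xs → Avoids132 xs → Avoids132 (map (c +_) xs)
  avoids-shift c xs av {i} {j} {k} ij jk kl p q =
    av ij jk kl' (+-cancelˡ-< c _ _ (subst₂ _<_ (at-map (c +_) xs (<-trans ij (<-trans jk kl'))) (at-map (c +_) xs kl') p))
                 (+-cancelˡ-< c _ _ (subst₂ _<_ (at-map (c +_) xs kl') (at-map (c +_) xs (<-trans jk kl')) q))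
    where kl' = subst (k <_) (length-map (c +_) xs) kl

  avoids-unshift : ∀ c xs → Avoids132 (map (c +_) xs) → Avoids132 xs
  avoids-unshift c xs av {i} {j} {k} ij jk kl p q =
    av ij jk kl' (subst₂ _<_ (sym (at-map (c +_) xs (<-trans ij (<-trans jk kl)))) (sym (at-map (c +_) xs kl)) (+-monoʳ-< c p))
                 (subst₂ _<_ (sym (at-map (c +_) xs kl)) (sym (at-map (c +_) xs (<-trans jk kl))) (+-monoʳ-< c q))
    where kl' = subst (k <_) (sym (length-map (c +_) xs)) kl

  isAbove : ℕ → ℕ → ℕ
  isAbove x y = if x <ᵇ y then 1 else 0

  countAbove : ℕ → List ℕ → ℕ
  countAbove x [] = 0
  countAbove x (y ∷ ys) = isAbove x y + countAbove x ys

  coinvList : List ℕ → ℕ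
  coinvList [] = 0
  coinvList (x ∷ xs) = countAbove x xs + coinvList xs

  crossCoinv : List ℕ → List ℕ → ℕ
  crossCoinv [] ys = 0
  crossCoinv (x ∷ xs) ys = countAbove x ys + crossCoinv xs ys

  countAbove-++ : ∀ x ys zs → countAbove x (ys ++ zs) ≡ countAbove x ys + countAbove x zs
  countAbove-++ x [] zs = refl
  countAbove-++ x (y ∷ ys) zs = trans (cong (isAbove x y +_) (countAbove-++ x ys zs)) (sym (+-assoc (isAbove x y) _ _))

  coinvList-++ : ∀ xs ys → coinvList (xs ++ ys) ≡ coinvList xs + coinvList ys + crossCoinv xs ys
  coinvList-++ [] ys = sym (+-identityʳ _)
  coinvList-++ (x ∷ xs) ys rewrite countAbove-++ x xs ys | coinvList-++ xs ys =
    solve 5 (λ a b c d e → (a :+ b) :+ ((c :+ d) :+ e) := ((a :+ c) :+ d) :+ (b :+ e)) refl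
      (countAbove x xs) (countAbove x ys) (coinvList xs) (coinvList ys) (crossCoinv xs ys)

  isAbove-shift : ∀ c x y → isAbove (c + x) (c + y) ≡ isAbove x y
  isAbove-shift zero x y = refl
  isAbove-shift (suc c) x y = isAbove-shift c x y

  countAbove-shift : ∀ c x ys → countAbove (c + x) (map (c +_) ys) ≡ countAbove x ys
  countAbove-shift c x [] = refl
  countAbove-shift c x (y ∷ ys) = cong₂ _+_ (isAbove-shift c x y) (countAbove-shift c x ys)

  coinvList-shift : ∀ c xs → coinvList (map (c +_) xs) ≡ coinvList xs
  coinvList-shift c [] = refl
  coinvList-shift c (x ∷ xs) = cong₂ _+_ (countAbove-shift c x xs) (coinvList-shift c xs)

  <⇒<ᵇ≡true : ∀ {x y} → x < y → (x <ᵇ y) ≡ true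
  <⇒<ᵇ≡true {zero} {suc y} p = refl
  <⇒<ᵇ≡true {suc x} {suc y} (s≤s p) = <⇒<ᵇ≡true p

  ≥⇒<ᵇ≡false : ∀ {x y} → y ≤ x → (x <ᵇ y) ≡ false
  ≥⇒<ᵇ≡false {x} {zero} p = refl
  ≥⇒<ᵇ≡false {suc x} {suc y} (s≤s p) = ≥⇒<ᵇ≡false p

  isAbove-≥ : ∀ {x y} → y ≤ x → isAbove x y ≡ 0
  isAbove-≥ p rewrite ≥⇒<ᵇ≡false p = refl

  isAbove-< : ∀ {x y} → x < y → isAbove x y ≡ 1
  isAbove-< p rewrite <⇒<ᵇ≡true p = refl

  countAbove-none : ∀ {x} ys → All (_≤ x) ys → countAbove x ys ≡ 0
  countAbove-none [] [] = refl
  countAbove-none (y ∷ ys) (p ∷ ps) rewrite isAbove-≥ p = countAbove-none ys ps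

  crossCoinv-none : ∀ xs ys → All (λ x → All (_≤ x) ys) xs → crossCoinv xs ys ≡ 0
  crossCoinv-none [] ys [] = refl
  crossCoinv-none (x ∷ xs) ys (p ∷ ps) rewrite countAbove-none ys p = crossCoinv-none xs ys ps

  crossCoinv-separated : ∀ xs ys c → All (c ≤_) xs → All (_< c) ys → crossCoinv xs ys ≡ 0
  crossCoinv-separated xs ys c cx cy = crossCoinv-none xs ys (All.map (λ {x} cq → All.map (λ {y} yq → <⇒≤ (<-≤-trans yq cq)) cy) cx)

  crossCoinv-snoc-max : ∀ xs y → All (_< y) xs → crossCoinv xs [ y ] ≡ length xs
  crossCoinv-snoc-max [] y [] = refl
  crossCoinv-snoc-max (x ∷ xs) y (p ∷ ps) rewrite isAbove-< p = cong suc (crossCoinv-snoc-max xs y ps)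

  coinvList-snoc-max : ∀ xs y → All (_< y) xs → coinvList (xs ++ [ y ]) ≡ coinvList xs + length xs
  coinvList-snoc-max xs y p rewrite coinvList-++ xs [ y ] | crossCoinv-snoc-max xs y p | +-identityʳ (coinvList xs) = refl


  InRange : List ℕ → Set
  InRange l = All (_< length l) l

  Involutive : List ℕ → Set
  Involutive l = ∀ i → i < length l → at l (at l i) ≡ i

  AvInv : List ℕ → Set
  AvInv l = InRange l × Involutive l × Avoids132 l

  -- β (of length 2m) swaps its halves: positions < m go to [m, 2m) and
  -- positions ≥ m go to [0, m).  Such 132-avoiding involutions are counted by
  -- the q²-Catalan numbers.
  Swaps : ℕ → List ℕ → Set
  Swaps m β = All (λ x → m ≤ x × x < m + m) (take m β) × All (_< m) (drop m β)

  swaps-intro : ∀ {m β} → length β ≡ m + m → (∀ i → i < m → m ≤ at β i × at β i < m + m) →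
             (∀ j → j < m → at β (m + j) < m) → Swaps m β
  swaps-intro {m} {β} lβ fa fb =
    at-All (take m β) (λ i p → let q = ≤-trans p (≤-trans (≤-reflexive (length-take m β)) (m⊓n≤m m _)) in
                                subst (λ z → m ≤ z × z < m + m) (sym (at-take m β q)) (fa i q)) ,
    at-All (drop m β) (λ j p → let q = subst (j <_) (trans (length-drop m β) (trans (cong (_∸ m) lβ) (m+n∸m≡n m m))) p in
                                subst (_< m) (sym (at-drop m β j)) (fb j q))

  swaps-lower : ∀ {m β} → length β ≡ m + m → Swaps m β → ∀ {i} → i < m → m ≤ at β i × at β i < m + m
  swaps-lower {m} {β} lβ sw {i} p = subst (λ x → m ≤ x × x < m + m) (at-take m β p)
    (All-at (proj₁ sw) (subst (i <_) (sym (trans (length-take m β) (m≤n⇒m⊓n≡m (subst (m ≤_) (sym lβ) (m≤m+n m m))))) p))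

  swaps-upper : ∀ {m β} → length β ≡ m + m → Swaps m β → ∀ {j} → j < m → at β (m + j) < m
  swaps-upper {m} {β} lβ sw {j} p = subst (_< m) (at-drop m β j)
    (All-at (proj₂ sw) (subst (j <_) (sym (trans (length-drop m β) (trans (cong (_∸ m) lβ) (m+n∸m≡n m m)))) p))

  -- Every
  -- 132-avoiding involution of [n+1] not fixing n is uniquely a frame.
  frameTop : ℕ → ℕ → ℕ
  frameTop m s = suc (m + s + m)

  frame : ℕ → ℕ → List ℕ → List ℕ → List ℕ
  frame m s β τ = (map (suc s +_) (take m β) ++ [ frameTop m s ]) ++ (map (suc m +_) τ ++ (drop m β ++ [ m ]))

  data Region (m s i : ℕ) : Set where
    rA : i < m → Region m s i
    rM : i ≡ m → Region m s i
    rT : ∀ j → j < s → i ≡ suc m + j → Region m s i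
    rB : ∀ j → j < m → i ≡ suc m + s + j → Region m s i
    rL : i ≡ frameTop m s → Region m s i

  region : ∀ m s i → i < suc (frameTop m s) → Region m s i
  region m s i lt with split-idx m i
  ... | inj₁ p = rA p
  ... | inj₂ (zero , e) = rM (trans e (+-identityʳ m))
  ... | inj₂ (suc d , e) with split-idx s d
  ...   | inj₁ p = rT d p (trans e (+-suc m d))
  ...   | inj₂ (d' , e') with split-idx m d'
  ...     | inj₁ p = rB d' p (trans e (trans (+-suc m d) (trans (cong (suc m +_) e') (sym (+-assoc (suc m) s d')))))
  ...     | inj₂ (g , e'') = rL (≤-antisym (≤-pred lt) top≤i)
    where
    top≤i : frameTop m s ≤ i
    top≤i rewrite e | e' | e'' = subst (_≤ m + suc (s + (m + g))) (sym top≡) (+-monoʳ-≤ m (s≤s (+-monoʳ-≤ s (m≤m+n m g))))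
      where
      top≡ : frameTop m s ≡ m + suc (s + m)
      top≡ = trans (cong suc (solve 2 (λ a b → a :+ b :+ a := a :+ (b :+ a)) refl m s)) (sym (+-suc m (s + m)))

  module FrameLayout {m s : ℕ} {β τ : List ℕ} (lβ : length β ≡ m + m) (lτ : length τ ≡ s) where
    fr A X T B R Y : List ℕ
    fr = frame m s β τ
    A = map (suc s +_) (take m β)
    X = A ++ [ frameTop m s ]
    T = map (suc m +_) τ
    B = drop m β
    R = B ++ [ m ]
    Y = T ++ R

    len-take : length (take m β) ≡ m
    len-take = trans (length-take m β) (trans (cong (m ⊓_) lβ) (m≤n⇒m⊓n≡m (m≤m+n m m)))

    len-drop : length (drop m β) ≡ m
    len-drop = trans (length-drop m β) (trans (cong (_∸ m) lβ) (m+n∸m≡n m m))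

    len-A : length A ≡ m
    len-A = trans (length-map _ (take m β)) len-take

    len-X : length X ≡ suc m
    len-X = trans (length-++ A) (trans (cong (_+ 1) len-A) (+-comm m 1))

    len-T : length T ≡ s
    len-T = trans (length-map _ τ) lτ

    len-R : length R ≡ suc m
    len-R = trans (length-++ B) (trans (cong (_+ 1) len-drop) (+-comm m 1))

    len-fr : length fr ≡ suc (frameTop m s)
    len-fr = trans (length-++ X) (trans (cong₂ _+_ len-X (trans (length-++ T) (cong₂ _+_ len-T len-R)))
               (solve 2 (λ a b → (con 1 :+ a) :+ (b :+ (con 1 :+ a)) := con 2 :+ (a :+ b :+ a)) refl m s))

    fr-A : ∀ {i} → i < m → at fr i ≡ suc s + at β i
    fr-A {i} p = trans (at-++ˡ X Y len-X (≤-trans p (n≤1+n m)))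
                (trans (at-++ˡ A _ len-A p) (trans (at-map _ (take m β) (subst (i <_) (sym len-take) p))
                  (cong (suc s +_) (at-take m β p))))

    fr-M : at fr m ≡ frameTop m s
    fr-M = trans (at-++ˡ X Y len-X (n<1+n m)) (trans (cong (at X) (sym (+-identityʳ m))) (at-++ʳ A _ len-A 0))

    fr-T : ∀ {j} → j < s → at fr (suc m + j) ≡ suc m + at τ j
    fr-T {j} p = trans (at-++ʳ X Y len-X j) (trans (at-++ˡ T R len-T p) (at-map _ τ (subst (j <_) (sym lτ) p)))

    fr-B : ∀ {j} → j < m → at fr (suc m + s + j) ≡ at β (m + j)
    fr-B {j} p = trans (cong (at fr) (+-assoc (suc m) s j)) (trans (at-++ʳ X Y len-X (s + j))
       (trans (at-++ʳ T R len-T j) (trans (at-++ˡ B _ len-drop p) (at-drop m β j))))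

    fr-L : at fr (frameTop m s) ≡ m
    fr-L = trans (cong (at fr) top≡) (trans (at-++ʳ X Y len-X (s + (m + 0)))
       (trans (at-++ʳ T R len-T (m + 0)) (at-++ʳ B _ len-drop 0)))
      where
      top≡ : frameTop m s ≡ suc m + (s + (m + 0))
      top≡ = cong suc (solve 2 (λ a b → a :+ b :+ a := a :+ (b :+ (a :+ con 0))) refl m s)

  A↦B-index : ∀ m s j → suc s + (m + j) ≡ suc m + s + j
  A↦B-index m s j = solve 3 (λ a b c → con 1 :+ b :+ (a :+ c) := con 1 :+ a :+ b :+ c) refl m s j

  s+2m≡m+s+m : ∀ m s → s + (m + m) ≡ m + s + m
  s+2m≡m+s+m = solve 2 (λ a b → b :+ (a :+ a) := a :+ b :+ a) refl

  inFrame-A : ∀ {m s x} → x < m + m → suc s + x < suc (frameTop m s)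
  inFrame-A {m} {s} {x} p = s≤s (s≤s (≤-trans (+-monoʳ-≤ s (<⇒≤ p)) (≤-reflexive (s+2m≡m+s+m m s))))

  inFrame-T : ∀ {m s y} → y < s → suc m + y < suc (frameTop m s)
  inFrame-T {m} {s} {y} p = s≤s (s≤s (≤-trans (+-monoʳ-≤ m (<⇒≤ p)) (m≤m+n (m + s) m)))

  inFrame-≤m : ∀ {m s x} → x ≤ m → x < suc (frameTop m s)
  inFrame-≤m {m} {s} p = s≤s (≤-trans p (≤-trans (m≤m+n m s) (≤-trans (m≤m+n (m + s) m) (n≤1+n _))))

  inFrame-B : ∀ {m s j} → j < m → suc m + s + j < suc (frameTop m s)
  inFrame-B {m} {s} jm = s≤s (s≤s (+-monoʳ-≤ (m + s) (<⇒≤ jm)))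

  module FrameProperties {m s : ℕ} {β τ : List ℕ} (lβ : length β ≡ m + m) (lτ : length τ ≡ s) (sw : Swaps m β) where
    open FrameLayout {m} {s} {β} {τ} lβ lτ

    upperHalf : ∀ {v} → m ≤ v → v < m + m → Σ ℕ λ j → j < m × v ≡ m + j
    upperHalf {v} p q = v ∸ m , +-cancelˡ-< m _ _ (subst (_< m + m) (sym (m+[n∸m]≡n p)) q) , sym (m+[n∸m]≡n p)

    ltfr : ∀ {i} → i < length fr → i < suc (frameTop m s)
    ltfr {i} p = subst (i <_) len-fr p

    take++drop-β : take m β ++ drop m β ≡ β
    take++drop-β = take++drop≡id m β

    avoids-halves : Avoids132 β → Avoids132 (take m β) × Avoids132 (drop m β)
    avoids-halves av = avoids-++ˡ (take m β) (drop m β) (subst Avoids132 (sym take++drop-β) av) ,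
                  avoids-++ʳ (take m β) (drop m β) (subst Avoids132 (sym take++drop-β) av)

    cX : All (suc (m + s) ≤_) X
    cX = ++⁺ (map⁺ (All.map (λ {x} q → subst (_≤ suc s + x) (cong suc (+-comm s m)) (+-monoʳ-≤ (suc s) (proj₁ q))) (proj₁ sw)))
             (s≤s (m≤m+n (m + s) m) ∷ [])

    cY : InRange τ → All (_< suc (m + s)) Y
    cY bτ = ++⁺ (map⁺ (All.map (λ {y} q → +-monoʳ-< (suc m) (subst (y <_) lτ q)) bτ))
             (++⁺ (All.map (λ q → ≤-trans q (≤-trans (n≤1+n m) (s≤s (m≤m+n m s)))) (proj₂ sw)) (s≤s (m≤m+n m s) ∷ []))

    inFr : ∀ {i} → i < suc (frameTop m s) → i < length fr
    inFr {i} p = subst (i <_) (sym len-fr) p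

    inβ : ∀ {i} → i < m + m → i < length β
    inβ {i} p = subst (i <_) (sym lβ) p

    cT : All (suc m ≤_) T
    cT = map⁺ (All.universal (λ x → m≤m+n (suc m) x) τ)

    cR : All (_< suc m) R
    cR = ++⁺ (All.map (λ q → ≤-trans q (n≤1+n m)) (proj₂ sw)) (n<1+n m ∷ [])

    cA : All (_< frameTop m s) A
    cA = map⁺ (All.map (λ {x} q → s≤s (subst (s + x <_) (s+2m≡m+s+m m s) (+-monoʳ-< s (proj₂ q)))) (proj₁ sw))

    bτ' : InRange τ → ∀ {j} → j < s → at τ j < s
    bτ' bτ {j} q = subst (at τ j <_) lτ (All-at bτ (subst (j <_) (sym lτ) q))

    avFr : Avoids132 β → InRange τ → Avoids132 τ → Avoids132 fr
    avFr avβ bτ avτ = avoids-++-separated X Y (suc (m + s)) cX (cY bτ)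
      (avoids-snoc-max A (frameTop m s) cA (avoids-shift (suc s) (take m β) (proj₁ (avoids-halves avβ))))
      (avoids-++-separated T R (suc m) cT cR (avoids-shift (suc m) τ avτ) (avoids-snoc-max B m (proj₂ sw) (proj₂ (avoids-halves avβ))))

    bndFr : InRange τ → InRange fr
    bndFr bτ = at-All fr λ i p → subst (at fr i <_) (sym len-fr) (go i (ltfr p))
      where
      go : ∀ i → i < suc (frameTop m s) → at fr i < suc (frameTop m s)
      go i p with region m s i p
      ... | rA q rewrite fr-A q = inFrame-A {m} {s} (proj₂ (swaps-lower lβ sw q))
      ... | rM refl rewrite fr-M = n<1+n _
      ... | rT j q refl rewrite fr-T q = inFrame-T {m} {s} (bτ' bτ q)
      ... | rB j q refl rewrite fr-B q = inFrame-≤m {m} {s} (<⇒≤ (swaps-upper lβ sw q))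
      ... | rL refl rewrite fr-L = inFrame-≤m {m} {s} ≤-refl

    invFr : Involutive β → InRange τ → Involutive τ → Involutive fr
    invFr iβ bτ iτ i p with region m s i (ltfr p)
    ... | rA q with upperHalf (proj₁ (swaps-lower lβ sw q)) (proj₂ (swaps-lower lβ sw q))
    ...   | j , jm , e = begin
          at fr (at fr i) ≡⟨ cong (at fr) (fr-A q) ⟩
          at fr (suc s + at β i) ≡⟨ cong (λ z → at fr (suc s + z)) e ⟩
          at fr (suc s + (m + j)) ≡⟨ cong (at fr) (A↦B-index m s j) ⟩
          at fr (suc m + s + j) ≡⟨ fr-B jm ⟩
          at β (m + j) ≡⟨ cong (at β) (sym e) ⟩
          at β (at β i) ≡⟨ iβ i (inβ (≤-trans q (m≤m+n m m))) ⟩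
          i ∎
      where open ≡-Reasoning
    invFr iβ bτ iτ i p | rM refl rewrite fr-M = fr-L
    invFr iβ bτ iτ i p | rT j q refl rewrite fr-T q | fr-T (bτ' bτ q) =
      cong (suc m +_) (iτ j (subst (j <_) (sym lτ) q))
    invFr iβ bτ iτ i p | rB j q refl rewrite fr-B q | fr-A (swaps-upper lβ sw q) =
      trans (cong (suc s +_) (iβ (m + j) (inβ (+-monoʳ-< m q)))) (A↦B-index m s j)
    invFr iβ bτ iτ i p | rL refl rewrite fr-L = fr-M

    invβ : Involutive fr → Involutive β
    invβ ifr i p with split-idx m i
    ... | inj₁ q with upperHalf (proj₁ (swaps-lower lβ sw q)) (proj₂ (swaps-lower lβ sw q))
    ...   | j , jm , e = begin
          at β (at β i) ≡⟨ cong (at β) e ⟩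
          at β (m + j) ≡⟨ sym (fr-B jm) ⟩
          at fr (suc m + s + j) ≡⟨ cong (at fr) (sym (A↦B-index m s j)) ⟩
          at fr (suc s + (m + j)) ≡⟨ cong (λ z → at fr (suc s + z)) (sym e) ⟩
          at fr (suc s + at β i) ≡⟨ cong (at fr) (sym (fr-A q)) ⟩
          at fr (at fr i) ≡⟨ ifr i (inFr (inFrame-≤m (<⇒≤ q))) ⟩
          i ∎
      where open ≡-Reasoning
    invβ ifr i p | inj₂ (j , refl) = +-cancelˡ-≡ (suc s) _ _ (trans eq (sym (A↦B-index m s j)))
      where
      jm : j < m
      jm = +-cancelˡ-< m _ _ (subst (m + j <_) lβ p)
      k = suc m + s + j
      eq : suc s + at β (at β (m + j)) ≡ suc m + s + j
      eq = trans (sym (fr-A (swaps-upper lβ sw jm))) (trans (cong (at fr) (sym (fr-B jm))) (ifr k (inFr (inFrame-B jm))))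

    bndβ : InRange β
    bndβ = at-All β λ i p → subst (at β i <_) (sym lβ) (go i p)
      where
      go : ∀ i → i < length β → at β i < m + m
      go i p with split-idx m i
      ... | inj₁ q = proj₂ (swaps-lower lβ sw q)
      ... | inj₂ (j , refl) = ≤-trans (swaps-upper lβ sw (+-cancelˡ-< m _ _ (subst (m + j <_) lβ p))) (m≤m+n m m)

    avβ : Avoids132 fr → Avoids132 β
    avβ av = subst Avoids132 take++drop-β (avoids-++-separated (take m β) (drop m β) m (All.map proj₁ (proj₁ sw)) (proj₂ sw)
      (avoids-unshift (suc s) (take m β) (avoids-++ˡ A [ frameTop m s ] (avoids-++ˡ X Y av)))
      (avoids-++ˡ B [ m ] (avoids-++ʳ T R (avoids-++ʳ X Y av))))

    avτ : Avoids132 fr → Avoids132 τ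
    avτ av = avoids-unshift (suc m) τ (avoids-++ˡ T R (avoids-++ʳ X Y av))

    -- τ stays within range, since values outside [0, s) lead to a different region
    bndτ : InRange fr → Involutive fr → InRange τ
    bndτ bfr ifr = at-All τ λ j p → subst (at τ j <_) (sym lτ) (go j (subst (j <_) lτ p))
      where
      go : ∀ j → j < s → at τ j < s
      go j p = go2 (region m s (suc m + at τ j) hb)
        where
        hb : suc m + at τ j < suc (frameTop m s)
        hb = subst (_< suc (frameTop m s)) (fr-T p) (subst (at fr (suc m + j) <_) len-fr (All-at bfr (inFr (inFrame-T {m} {s} p))))
        ii : at fr (at fr (suc m + j)) ≡ suc m + j
        ii = ifr (suc m + j) (inFr (inFrame-T {m} {s} p))
        go2 : Region m s (suc m + at τ j) → at τ j < s
        go2 (rA q) = ⊥-elim (<-asym q (s≤s (m≤m+n m _)))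
        go2 (rM e) = ⊥-elim (<-irrefl (sym e) (s≤s (m≤m+n m _)))
        go2 (rT j' q e) = subst (_< s) (sym (+-cancelˡ-≡ (suc m) _ _ e)) q
        go2 (rB j' q e) = ⊥-elim (<-asym lt (s≤s (m≤m+n m j)))
          where
          lt : suc m + j < m
          lt = subst (_< m) (trans (sym (fr-B q)) (trans (cong (at fr) (trans (sym e) (sym (fr-T p)))) ii)) (swaps-upper lβ sw q)
        go2 (rL e) = ⊥-elim (<-irrefl (trans (sym fr-L) (trans (cong (at fr) (trans (sym e) (sym (fr-T p)))) ii)) (s≤s (m≤m+n m j)))

    invτ : InRange τ → Involutive fr → Involutive τ
    invτ bτ ifr j p = +-cancelˡ-≡ (suc m) _ _ (trans (sym (fr-T (bτ' bτ q))) (trans (cong (at fr) (sym (fr-T q))) (ifr (suc m + j) (inFr (inFrame-T {m} {s} q)))))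
      where q = subst (j <_) lτ p

    frame-AvInv : Involutive β → Avoids132 β → AvInv τ → AvInv fr
    frame-AvInv iβ aβ (bτ , iτ , aτ) = bndFr bτ , invFr iβ bτ iτ , avFr aβ bτ aτ

    frame-AvInv⁻ : AvInv fr → AvInv β × AvInv τ
    frame-AvInv⁻ (bfr , ifr , afr) = (bndβ , invβ ifr , avβ afr) , (bτ , invτ bτ ifr , avτ afr)
      where bτ = bndτ bfr ifr

  pigeonhole-ℕ : ∀ a b (g : ℕ → ℕ) → (∀ i → i < a → g i < b) →
                 (∀ i j → i < a → j < a → g i ≡ g j → i ≡ j) → a ≤ b
  pigeonhole-ℕ a b g bd inj with a ≤? b
  ... | yes p = p
  ... | no np with FP.pigeonhole (≰⇒> np) (λ i → fromℕ< (bd (toℕ i) (FP.toℕ<n i)))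
  ...   | i , j , i<j , e = ⊥-elim (<-irrefl (inj (toℕ i) (toℕ j) (FP.toℕ<n i) (FP.toℕ<n j)
            (trans (sym (FP.toℕ-fromℕ< (bd (toℕ i) (FP.toℕ<n i)))) (trans (cong toℕ e) (FP.toℕ-fromℕ< (bd (toℕ j) (FP.toℕ<n j)))))) i<j)

  at-map∸ : ∀ c xs i → at (map (_∸ c) xs) i ≡ at xs i ∸ c
  at-map∸ c [] i = sym (0∸n≡0 c)
  at-map∸ c (x ∷ xs) zero = refl
  at-map∸ c (x ∷ xs) (suc i) = at-map∸ c xs i

  length-take-≤ : ∀ k (xs : List ℕ) → k ≤ length xs → length (take k xs) ≡ k
  length-take-≤ k xs p = trans (length-take k xs) (m≤n⇒m⊓n≡m p)

  -- Let ι be a 132-avoiding involution of [n+1] with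
  -- last value m < n, so ι(m) = n.  Writing f = ι:
  --   (a) for i < m < k, f k < f i  (else i, m, k would form a 132);
  --   (b) for i < m, m < f i < n, so by pigeonhole 2m+1 ≤ n; put
  --       s = n - (2m+1), t = m+1+s, so that n = frameTop m s;
  --   (c) for i < m, t ≤ f i  and (d) for t ≤ p < n, f p < m,
  --       both again by counting the values available to an injection;
  --   (e) for m < p < t, m < f p.
  -- Hence ι = frame m s β τ where β collects the values at positions
  -- [0, m) ∪ [t, n) and τ those at (m, t), suitably shifted.
  module Decompose {n m : ℕ} {ι : List ℕ} (lι : length ι ≡ suc n) (gι : AvInv ι) (lst : at ι n ≡ m) (mn : m < n) where
    f : ℕ → ℕ
    f = at ι

    f< : ∀ {i} → i < suc n → f i < suc n
    f< {i} p = subst (f i <_) lι (All-at (proj₁ gι) (subst (i <_) (sym lι) p))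

    f-inv : ∀ {i} → i < suc n → f (f i) ≡ i
    f-inv {i} p = proj₁ (proj₂ gι) i (subst (i <_) (sym lι) p)

    f-avoids : Avoids132 ι
    f-avoids = proj₂ (proj₂ gι)

    f-inj : ∀ {i j} → i < suc n → j < suc n → f i ≡ f j → i ≡ j
    f-inj p q e = trans (sym (f-inv p)) (trans (cong f e) (f-inv q))

    nsn : n < suc n
    nsn = n<1+n n

    msn : m < suc n
    msn = <-trans mn nsn

    f[m]≡n : f m ≡ n
    f[m]≡n = trans (cong f (sym lst)) (f-inv nsn)

    f<n : ∀ {k} → k < suc n → k ≢ m → f k < n
    f<n {k} p ne with m≤n⇒m<n∨m≡n (≤-pred (f< p))
    ... | inj₁ q = q
    ... | inj₂ e = ⊥-elim (ne (f-inj p msn (trans e (sym f[m]≡n))))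

    decreasing-across-m : ∀ {i k} → i < m → m < k → k < suc n → f k < f i
    decreasing-across-m {i} {k} im mk ksn with <-cmp (f k) (f i)
    ... | tri< lt _ _ = lt
    ... | tri≈ _ e _ = ⊥-elim (<-irrefl (f-inj (<-trans im msn) ksn (sym e)) (<-trans im mk))
    ... | tri> _ _ gt = ⊥-elim (f-avoids im mk (subst (k <_) (sym lι) ksn) gt (subst (f k <_) (sym f[m]≡n) (f<n ksn (λ e → <-irrefl (sym e) mk))))

    initial-above-m : ∀ {i} → i < m → m < f i
    initial-above-m {i} im = subst (_< f i) lst (decreasing-across-m im mn nsn)

    initial-below-n : ∀ {i} → i < m → f i < n
    initial-below-n {i} im = f<n (<-trans im msn) (λ e → <-irrefl e im)

    m+1+m≤n : m + suc m ≤ n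
    m+1+m≤n = m≤o∸n⇒m+n≤o m mn (pigeonhole-ℕ m (n ∸ suc m) (λ i → f i ∸ suc m)
             (λ i p → ∸-monoˡ-< (initial-below-n p) (initial-above-m p))
             (λ i j p q e → f-inj (<-trans p msn) (<-trans q msn) (∸-cancelʳ-≡ (initial-above-m p) (initial-above-m q) e)))

    s : ℕ
    s = n ∸ suc (m + m)

    t : ℕ
    t = suc m + s

    n≡frameTop : n ≡ frameTop m s
    n≡frameTop = trans (sym (m+[n∸m]≡n (subst (_≤ n) (+-suc m m) m+1+m≤n)))
                       (cong suc (solve 2 (λ a b → a :+ a :+ b := a :+ b :+ a) refl m s))

    t≤n : t ≤ n
    t≤n = subst (t ≤_) (sym n≡frameTop) (s≤s (m≤m+n (m + s) m))

    -- (c) the values f i (i < m) form a decreasing run that must leave room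
    -- for the n - f i values f p (f i ≤ p < n), all of which lie below m
    initial-above-t : ∀ {i} → i < m → t ≤ f i
    initial-above-t {i0} im with t ≤? f i0
    ... | yes p = p
    ... | no np = ⊥-elim (<-irrefl refl (<-≤-trans (+-monoʳ-< m v<t) (≤-trans (≤-reflexive (trans (+-comm m t) (sym n≡frameTop))) n≤m+v)))
      where
      v = f i0
      v<t : v < t
      v<t = ≰⇒> np
      below-m : ∀ p → v ≤ p → p < n → f p < m
      below-m p vp pn with <-cmp (f p) m
      ... | tri< lt _ _ = lt
      ... | tri≈ _ e _ = ⊥-elim (<-irrefl (f-inj (<-trans pn nsn) nsn (trans e (sym lst))) pn)
      ... | tri> _ _ gt = ⊥-elim (<-irrefl refl (<-≤-trans (subst (_< v) (f-inv (<-trans pn nsn)) (decreasing-across-m im gt (f< (<-trans pn nsn)))) vp))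
      v+ : ∀ {p'} → p' < n ∸ v → v + p' < n
      v+ {p'} q = subst (v + p' <_) (m+[n∸m]≡n (<⇒≤ (initial-below-n im))) (+-monoʳ-< v q)
      n∸v≤m : n ∸ v ≤ m
      n∸v≤m = pigeonhole-ℕ (n ∸ v) m (λ p' → f (v + p'))
             (λ p' q → below-m (v + p') (m≤m+n v p') (v+ q))
             (λ p' q' a b e → +-cancelˡ-≡ v _ _ (f-inj (<-trans (v+ a) nsn) (<-trans (v+ b) nsn) e))
      n≤m+v : n ≤ m + v
      n≤m+v = subst (n ≤_) (+-comm v m) (subst (_≤ v + m) (m+[n∸m]≡n (<⇒≤ (initial-below-n im))) (+-monoʳ-≤ v n∸v≤m))

    -- (d) a value f p ≥ m at t ≤ p < n would push all m values f i (i < m)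
    -- into (p, n), which has too few elements
    tail-below-m : ∀ {p} → t ≤ p → p < n → f p < m
    tail-below-m {p} tp pn with <-cmp (f p) m
    ... | tri< lt _ _ = lt
    ... | tri≈ _ e _ = ⊥-elim (<-irrefl (f-inj (<-trans pn nsn) nsn (trans e (sym lst))) pn)
    ... | tri> _ _ gt = ⊥-elim (<-irrefl refl (<-≤-trans n<m+1+p (m≤o∸n⇒m+n≤o m pn m≤n∸1+p)))
      where
      above-p : ∀ {i} → i < m → p < f i
      above-p im = subst (_< f _) (f-inv (<-trans pn nsn)) (decreasing-across-m im gt (f< (<-trans pn nsn)))
      m≤n∸1+p : m ≤ n ∸ suc p
      m≤n∸1+p = pigeonhole-ℕ m (n ∸ suc p) (λ i → f i ∸ suc p) (λ i q → ∸-monoˡ-< (initial-below-n q) (above-p q))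
             (λ i j a b e → f-inj (<-trans a msn) (<-trans b msn) (∸-cancelʳ-≡ (above-p a) (above-p b) e))
      n<m+1+p : n < m + suc p
      n<m+1+p = subst (_< m + suc p) (trans (+-comm m t) (sym n≡frameTop)) (+-monoʳ-< m (s≤s tp))

    -- (e) f p < m would contradict (c) applied to f p
    middle-above-m : ∀ {p} → m < p → p < t → m < f p
    middle-above-m {p} mp pt with <-cmp (f p) m
    ... | tri< lt _ _ = ⊥-elim (<-irrefl refl (<-≤-trans pt (subst (t ≤_) (f-inv psn) (initial-above-t lt))))
      where psn = <-trans (<-≤-trans pt t≤n) nsn
    ... | tri≈ _ e _ = ⊥-elim (<-irrefl (f-inj (<-trans (<-≤-trans pt t≤n) nsn) nsn (trans e (sym lst))) (<-≤-trans pt t≤n))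
    ... | tri> _ _ gt = gt

    b1 b2 β τ : List ℕ
    b1 = map (_∸ suc s) (take m ι)
    b2 = take m (drop t ι)
    β = b1 ++ b2
    τ = map (_∸ suc m) (take s (drop (suc m) ι))

    +≤⇒≤∸ : ∀ {a b c} → a + b ≤ c → b ≤ c ∸ a
    +≤⇒≤∸ {a} {b} {c} p = subst (_≤ c ∸ a) (m+n∸m≡n a b) (∸-monoˡ-≤ a p)

    lenι : length ι ≡ suc (frameTop m s)
    lenι = trans lι (cong suc n≡frameTop)

    l-b1 : length b1 ≡ m
    l-b1 = trans (length-map _ (take m ι)) (length-take-≤ m ι (subst (m ≤_) (sym lι) (<⇒≤ msn)))

    l-b2 : length b2 ≡ m
    l-b2 = length-take-≤ m (drop t ι) (subst (m ≤_) (sym (trans (length-drop t ι) (cong (_∸ t) lenι)))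
             (+≤⇒≤∸ {t} {m} (n≤1+n _)))

    lβ : length β ≡ m + m
    lβ = trans (length-++ b1) (cong₂ _+_ l-b1 l-b2)

    lτ : length τ ≡ s
    lτ = trans (length-map _ (take s (drop (suc m) ι))) (length-take-≤ s (drop (suc m) ι)
           (subst (s ≤_) (sym (trans (length-drop (suc m) ι) (cong (_∸ suc m) lenι)))
             (+≤⇒≤∸ {suc m} {s} (≤-trans (m≤m+n (suc m + s) m) (n≤1+n _)))))

    at-b1 : ∀ {i} → i < m → at β i ≡ f i ∸ suc s
    at-b1 {i} p = trans (at-++ˡ b1 b2 l-b1 p) (trans (at-map∸ (suc s) (take m ι) i) (cong (_∸ suc s) (at-take m ι p)))

    at-b2 : ∀ {j} → j < m → at β (m + j) ≡ f (t + j)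
    at-b2 {j} p = trans (at-++ʳ b1 b2 l-b1 j) (trans (at-take m (drop t ι) p) (at-drop t ι j))

    at-τ : ∀ {j} → j < s → at τ j ≡ f (suc m + j) ∸ suc m
    at-τ {j} p = trans (at-map∸ (suc m) (take s (drop (suc m) ι)) j) (cong (_∸ suc m) (trans (at-take s (drop (suc m) ι) p) (at-drop (suc m) ι j)))

    -- (c) and (d) say exactly that β swaps its halves
    β-swaps : Swaps m β
    β-swaps = swaps-intro lβ lower upper
      where
      lower : ∀ i → i < m → m ≤ at β i × at β i < m + m
      lower i q = subst (λ z → m ≤ z × z < m + m) (sym (at-b1 q))
        ( subst (_≤ f i ∸ suc s) (m+n∸n≡m m s) (∸-monoˡ-≤ (suc s) (initial-above-t q))
        , subst (f i ∸ suc s <_) (trans (cong (_∸ suc s) n≡frameTop) top∸s)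
                (∸-monoˡ-< (initial-below-n q) (≤-trans (s≤s (m≤n+m s m)) (initial-above-t q))))
        where
        top∸s : m + s + m ∸ s ≡ m + m
        top∸s = trans (cong (_∸ s) (solve 2 (λ a b → a :+ b :+ a := a :+ a :+ b) refl m s)) (m+n∸n≡m (m + m) s)
      upper : ∀ j → j < m → at β (m + j) < m
      upper j q = subst (_< m) (sym (at-b2 q)) (tail-below-m (m≤m+n t j) (subst (t + j <_) (sym n≡frameTop) (+-monoʳ-< t q)))

    ι≡frame : ι ≡ frame m s β τ
    ι≡frame = list-ext ι (frame m s β τ) (trans lenι (sym len-fr)) λ i p → go i (region m s i (subst (i <_) lenι p))
      where
      open FrameLayout {m} {s} {β} {τ} lβ lτ
      go : ∀ i → Region m s i → at ι i ≡ at (frame m s β τ) i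
      go i (rA q) = sym (trans (fr-A q) (trans (cong (suc s +_) (at-b1 q)) (m+[n∸m]≡n (≤-trans (s≤s (m≤n+m s m)) (initial-above-t q)))))
      go i (rM refl) = trans f[m]≡n (trans n≡frameTop (sym fr-M))
      go i (rT j q refl) = sym (trans (fr-T q) (trans (cong (suc m +_) (at-τ q))
                              (m+[n∸m]≡n (middle-above-m (s≤s (m≤m+n m j)) (+-monoʳ-< (suc m) q)))))
      go i (rB j q refl) = sym (trans (fr-B q) (at-b2 q))
      go i (rL refl) = trans (cong f (sym n≡frameTop)) (trans lst (sym fr-L))

    result : Σ ℕ λ s' → (n ≡ frameTop m s') × Σ (List ℕ) λ β' → Σ (List ℕ) λ τ' →
             length β' ≡ m + m × length τ' ≡ s' × Swaps m β' × AvInv β' × AvInv τ' × ι ≡ frame m s' β' τ'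
    result = s , n≡frameTop , β , τ , lβ , lτ , β-swaps , proj₁ pieces , proj₂ pieces , ι≡frame
      where
      open FrameProperties {m} {s} {β} {τ} lβ lτ β-swaps
      pieces = frame-AvInv⁻ (subst AvInv ι≡frame gι)

  avInv-snoc-fixed : ∀ {n τ} → length τ ≡ n → AvInv τ → AvInv (τ ++ [ n ])
  avInv-snoc-fixed {n} {τ} lτ (bτ , iτ , aτ) = bnd , inv , avoids-snoc-max τ n bτ' aτ
    where
    bτ' : All (_< n) τ
    bτ' = subst (λ z → All (_< z) τ) lτ bτ
    len : length (τ ++ [ n ]) ≡ suc n
    len = trans (length-++ τ) (trans (cong (_+ 1) lτ) (+-comm n 1))
    atL : ∀ {i} → i < n → at (τ ++ [ n ]) i ≡ at τ i
    atL p = at-++ˡ τ [ n ] lτ p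
    atN : at (τ ++ [ n ]) n ≡ n
    atN = trans (cong (at (τ ++ [ n ])) (sym (+-identityʳ n))) (at-++ʳ τ [ n ] lτ 0)
    bnd : InRange (τ ++ [ n ])
    bnd = subst (λ z → All (_< z) (τ ++ [ n ])) (sym len) (++⁺ (All.map (λ q → ≤-trans q (n≤1+n n)) bτ') (n<1+n n ∷ []))
    inv : Involutive (τ ++ [ n ])
    inv i p with m≤n⇒m<n∨m≡n (≤-pred (subst (i <_) len p))
    ... | inj₁ q = let r = All-at bτ' (subst (i <_) (sym lτ) q) in
                   trans (cong (at (τ ++ [ n ])) (atL q)) (trans (atL r) (iτ i (subst (i <_) (sym lτ) q)))
    ... | inj₂ refl = trans (cong (at (τ ++ [ n ])) atN) atN

  avInv-unsnoc-fixed : ∀ {n ι} → length ι ≡ suc n → AvInv ι → at ι n ≡ n →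
        Σ (List ℕ) λ τ → length τ ≡ n × AvInv τ × ι ≡ τ ++ [ n ]
  avInv-unsnoc-fixed {n} {ι} lι (bι , iι , aι) lst = τ , lτ , (bτ , iτ , avoids-++ˡ τ [ n ] (subst Avoids132 eq aι)) , eq
    where
    τ : List ℕ
    τ = take n ι
    lτ : length τ ≡ n
    lτ = length-take-≤ n ι (subst (n ≤_) (sym lι) (n≤1+n n))
    f : ℕ → ℕ
    f = at ι
    inv : ∀ {i} → i < suc n → f (f i) ≡ i
    inv {i} p = iι i (subst (i <_) (sym lι) p)
    bnd : ∀ {i} → i < suc n → f i < suc n
    bnd {i} p = subst (f i <_) lι (All-at bι (subst (i <_) (sym lι) p))
    eq : ι ≡ τ ++ [ n ]
    eq = list-ext ι (τ ++ [ n ]) (trans lι (sym (trans (length-++ τ) (trans (cong (_+ 1) lτ) (+-comm n 1)))))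
      λ i p → go i (m≤n⇒m<n∨m≡n (≤-pred (subst (i <_) lι p)))
      where
      go : ∀ i → i < n ⊎ i ≡ n → at ι i ≡ at (τ ++ [ n ]) i
      go i (inj₁ q) = sym (trans (at-++ˡ τ [ n ] lτ q) (at-take n ι q))
      go i (inj₂ refl) = trans lst (sym (trans (cong (at (τ ++ [ n ])) (sym (+-identityʳ n))) (at-++ʳ τ [ n ] lτ 0)))
    atτ : ∀ {i} → i < n → at τ i ≡ f i
    atτ q = at-take n ι q
    fi<n : ∀ {i} → i < n → f i < n
    fi<n {i} q with m≤n⇒m<n∨m≡n (≤-pred (bnd (≤-trans q (n≤1+n n))))
    ... | inj₁ r = r
    ... | inj₂ e = ⊥-elim (<-irrefl (trans (sym (inv (≤-trans q (n≤1+n n)))) (trans (cong f e) lst)) q)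
    bτ : InRange τ
    bτ = at-All τ λ i p → let q = subst (i <_) lτ p in subst (_< length τ) (sym (atτ q)) (subst (f i <_) (sym lτ) (fi<n q))
    iτ : Involutive τ
    iτ i p = let q = subst (i <_) lτ p in
      trans (cong (at τ) (atτ q)) (trans (atτ (fi<n q)) (inv (≤-trans q (n≤1+n n))))

  frame-injective : ∀ {m s β τ β' τ'} → length β ≡ m + m → length τ ≡ s → length β' ≡ m + m → length τ' ≡ s →
           frame m s β τ ≡ frame m s β' τ' → β ≡ β' × τ ≡ τ'
  frame-injective {m} {s} {β} {τ} {β'} {τ'} lβ lτ lβ' lτ' e =
    list-ext β β' (trans lβ (sym lβ')) gβ , list-ext τ τ' (trans lτ (sym lτ')) gτ
    where
    module U = FrameLayout {m} {s} {β} {τ} lβ lτ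
    module V = FrameLayout {m} {s} {β'} {τ'} lβ' lτ'
    gβ : ∀ i → i < length β → at β i ≡ at β' i
    gβ i p with split-idx m i
    ... | inj₁ q = +-cancelˡ-≡ (suc s) _ _ (trans (sym (U.fr-A q)) (trans (cong (λ z → at z i) e) (V.fr-A q)))
    ... | inj₂ (j , refl) = let q = +-cancelˡ-< m _ _ (subst (m + j <_) lβ p) in
          trans (sym (U.fr-B q)) (trans (cong (λ z → at z (suc m + s + j)) e) (V.fr-B q))
    gτ : ∀ j → j < length τ → at τ j ≡ at τ' j
    gτ j p = let q = subst (j <_) lτ p in
      +-cancelˡ-≡ (suc m) _ _ (trans (sym (U.fr-T q)) (trans (cong (λ z → at z (suc m + j)) e) (V.fr-T q)))

  -- Coinversions of the two kinds of decomposition: a final fixed point n adds n,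
  -- a frame adds 2m (the prefix values above top's left, and the final m).
  coinv-snoc-fixed : ∀ {n τ} → length τ ≡ n → InRange τ → coinvList (τ ++ [ n ]) ≡ n + coinvList τ
  coinv-snoc-fixed {n} {τ} lτ bτ = trans (coinvList-snoc-max τ n (subst (λ z → All (_< z) τ) lτ bτ)) (trans (cong (coinvList τ +_) lτ) (+-comm (coinvList τ) n))

  coinv-frame : ∀ {m s β τ} → (lβ : length β ≡ m + m) → (lτ : length τ ≡ s) → Swaps m β → InRange τ →
             coinvList (frame m s β τ) ≡ m + m + (coinvList β + coinvList τ)
  coinv-frame {m} {s} {β} {τ} lβ lτ sw bτ = begin
    coinvList (X ++ Y) ≡⟨ coinvList-++ X Y ⟩
    coinvList X + coinvList Y + crossCoinv X Y ≡⟨ cong (coinvList X + coinvList Y +_) (crossCoinv-separated X Y (suc (m + s)) cX (cY bτ)) ⟩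
    coinvList X + coinvList Y + 0 ≡⟨ cong₂ (λ a b → a + b + 0) cXv cYv ⟩
    (coinvList (take m β) + m) + (coinvList τ + (coinvList B + m)) + 0
      ≡⟨ solve 4 (λ a b c d → (a :+ d) :+ (b :+ (c :+ d)) :+ con 0 := d :+ d :+ ((a :+ c :+ con 0) :+ b)) refl
                 (coinvList (take m β)) (coinvList τ) (coinvList B) m ⟩
    m + m + ((coinvList (take m β) + coinvList B + 0) + coinvList τ) ≡⟨ cong (λ z → m + m + (z + coinvList τ)) (sym cβ) ⟩
    m + m + (coinvList β + coinvList τ) ∎
    where
    open ≡-Reasoning
    open FrameLayout {m} {s} {β} {τ} lβ lτ
    open FrameProperties {m} {s} {β} {τ} lβ lτ sw
    cXv : coinvList X ≡ coinvList (take m β) + m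
    cXv = trans (coinvList-snoc-max A (frameTop m s) cA) (cong₂ _+_ (coinvList-shift (suc s) (take m β)) len-A)
    cYv : coinvList Y ≡ coinvList τ + (coinvList B + m)
    cYv = trans (coinvList-++ T R) (trans (cong (coinvList T + coinvList R +_) (crossCoinv-separated T R (suc m) cT cR))
            (trans (+-identityʳ _) (cong₂ _+_ (coinvList-shift (suc m) τ)
              (trans (coinvList-snoc-max B m (proj₂ sw)) (cong (coinvList B +_) len-drop)))))
    cβ : coinvList β ≡ coinvList (take m β) + coinvList B + 0
    cβ = trans (cong coinvList (sym (take++drop≡id m β))) (trans (coinvList-++ (take m β) B)
           (cong (coinvList (take m β) + coinvList B +_) (crossCoinv-separated (take m β) B m (All.map proj₁ (proj₁ sw)) (proj₂ sw))))

  frameSwaps-length : ∀ j k → suc (frameTop j (k + k)) ≡ suc (j + k) + suc (j + k)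
  frameSwaps-length = solve 2 (λ j k → con 2 :+ (j :+ (k :+ k) :+ j) := (con 1 :+ (j :+ k)) :+ (con 1 :+ (j :+ k))) refl

  frameSwaps-lowerShift : ∀ j k → suc (suc (k + k) + (j + j)) ≡ suc (j + k) + suc (j + k)
  frameSwaps-lowerShift = solve 2 (λ j k → con 1 :+ (con 1 :+ (k :+ k) :+ (j :+ j)) := (con 1 :+ (j :+ k)) :+ (con 1 :+ (j :+ k))) refl

  frameSwaps-middleShift : ∀ j k → suc (j + k) + suc (j + k) ≡ suc j + (k + k) + suc j
  frameSwaps-middleShift = solve 2 (λ j k → (con 1 :+ (j :+ k)) :+ (con 1 :+ (j :+ k)) := (con 1 :+ j) :+ (k :+ k) :+ (con 1 :+ j)) refl

  module FrameOfSwaps {j k : ℕ} {β1 β2 : List ℕ} (l1 : length β1 ≡ j + j) (sw₁ : Swaps j β1) (l2 : length β2 ≡ k + k) where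
    s M : ℕ
    s = k + k
    M = suc (j + k)
    open FrameLayout {j} {s} {β1} {β2} l1 l2

    lenfr : length fr ≡ M + M
    lenfr = trans len-fr (frameSwaps-length j k)

    toTop : ∀ {i} → i < M + M → i < suc (frameTop j s)
    toTop {i} p = subst (i <_) (sym (frameSwaps-length j k)) p

    module Fwd (sw₂ : Swaps k β2) where
      lower : ∀ i → i < M → M ≤ at fr i × at fr i < M + M
      lower i p with region j s i (toTop (≤-trans p (m≤m+n M M)))
      ... | rA q rewrite fr-A q = let r = swaps-lower l1 sw₁ q in
            subst (_≤ suc s + at β1 i) (cong suc (+-comm k j)) (s≤s (+-mono-≤ (m≤m+n k k) (proj₁ r))) ,
            <-trans (+-monoʳ-< (suc s) (proj₂ r)) (subst (suc s + (j + j) <_) (frameSwaps-lowerShift j k) (n<1+n _))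
      ... | rM refl rewrite fr-M = s≤s (≤-trans (+-monoʳ-≤ _ (m≤m+n k k)) (m≤m+n _ _)) ,
            subst (frameTop j s <_) (frameSwaps-length j k) (n<1+n _)
      ... | rT l q refl rewrite fr-T q =
            let lk : l < k
                lk = +-cancelˡ-< (suc j) _ _ p
                r = swaps-lower l2 sw₂ lk in
            s≤s (+-monoʳ-≤ j (proj₁ r)) ,
            <-≤-trans (+-monoʳ-< (suc j) (proj₂ r)) (subst (suc j + (k + k) ≤_) (sym (frameSwaps-middleShift j k)) (m≤m+n _ _))
      ... | rB l q refl = ⊥-elim (<-irrefl refl (<-≤-trans p (s≤s (≤-trans (+-monoʳ-≤ j (m≤m+n k k)) (m≤m+n _ l)))))
      ... | rL refl = ⊥-elim (<-irrefl refl (<-≤-trans p (s≤s (≤-trans (+-monoʳ-≤ j (m≤m+n k k)) (m≤m+n _ j)))))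

      upper : ∀ l → l < M → at fr (M + l) < M
      upper l p with region j s (M + l) (toTop (+-monoʳ-< M p))
      ... | rA q = ⊥-elim (<-irrefl refl (<-trans q (s≤s (≤-trans (m≤m+n j k) (m≤m+n _ l)))))
      ... | rM e = ⊥-elim (<-irrefl (sym e) (s≤s (≤-trans (m≤m+n j k) (m≤m+n _ l))))
      ... | rT l' q e rewrite e | fr-T q =
            let e' : l' ≡ k + l
                e' = +-cancelˡ-≡ (suc j) _ _ (trans (sym e) (+-assoc (suc j) k l))
                lk : l < k
                lk = +-cancelˡ-< k _ _ (subst (_< k + k) e' q) in
            subst (λ z → suc j + at β2 z < M) (sym e') (+-monoʳ-< (suc j) (swaps-upper l2 sw₂ lk))
      ... | rB l' q e rewrite e | fr-B q = <-trans (swaps-upper l1 sw₁ q) (s≤s (m≤m+n j k))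
      ... | rL e rewrite e | fr-L = s≤s (m≤m+n j k)

      frame-swaps : Swaps M fr
      frame-swaps = swaps-intro lenfr lower upper

    module Bwd (g2 : AvInv β2) (swM : Swaps M fr) where
      inner-swaps : Swaps k β2
      inner-swaps = swaps-intro l2 lower upper
        where
        lower : ∀ l → l < k → k ≤ at β2 l × at β2 l < k + k
        lower l p = +-cancelˡ-≤ (suc j) _ _ (subst (M ≤_) (fr-T (≤-trans p (m≤m+n k k))) (proj₁ (swaps-lower lenfr swM (+-monoʳ-< (suc j) p)))) ,
                    subst (at β2 l <_) l2 (All-at (proj₁ g2) (subst (l <_) (sym l2) (≤-trans p (m≤m+n k k))))
        upper : ∀ l → l < k → at β2 (k + l) < k
        upper l p = +-cancelˡ-< (suc j) _ _ (subst (_< M) (trans (cong (at fr) (+-assoc (suc j) k l)) (fr-T (+-monoʳ-< k p)))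
                      (swaps-upper lenfr swM (<-trans p (s≤s (m≤n+m k j)))))

  lastValue : List ℕ → ℕ
  lastValue l = at l (pred (length l))

  lastValue-at : ∀ {l n} → length l ≡ suc n → lastValue l ≡ at l n
  lastValue-at {l} e = cong (at l) (cong pred e)

  frame-avInv : ∀ {m s β τ} → length β ≡ m + m → Swaps m β → AvInv β → length τ ≡ s → AvInv τ →
       length (frame m s β τ) ≡ suc (frameTop m s) × AvInv (frame m s β τ) × lastValue (frame m s β τ) ≡ m
  frame-avInv {m} {s} {β} {τ} lβ sw (_ , iβ , aβ) lτ gτ =
    len-fr , FrameProperties.frame-AvInv {m} {s} {β} {τ} lβ lτ sw iβ aβ gτ ,
    trans (cong (at (frame m s β τ)) (cong pred len-fr)) fr-L
    where open FrameLayout {m} {s} {β} {τ} lβ lτ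

  frame-of-swaps : ∀ {j k β1 β2} → length β1 ≡ j + j → Swaps j β1 → AvInv β1 → length β2 ≡ k + k → Swaps k β2 → AvInv β2 →
       length (frame j (k + k) β1 β2) ≡ suc (j + k) + suc (j + k) × AvInv (frame j (k + k) β1 β2) ×
       Swaps (suc (j + k)) (frame j (k + k) β1 β2) × lastValue (frame j (k + k) β1 β2) ≡ j
  frame-of-swaps {j} {k} {β1} {β2} l1 sw₁ g1 l2 sw₂ g2 with frame-avInv l1 sw₁ g1 l2 g2
  ... | len , g , last = trans len (frameSwaps-length j k) , g , FrameOfSwaps.Fwd.frame-swaps {j} {k} {β1} {β2} l1 sw₁ l2 sw₂ , last

  frameSwaps-gap : ∀ j k s' → j + k + suc (j + k) ≡ suc (j + s' + j) → s' ≡ k + k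
  frameSwaps-gap j k s' e = +-cancelˡ-≡ (j + j) _ _ (trans (solve 3 (λ j k s → j :+ j :+ s := j :+ s :+ j) refl j k s')
                  (trans (suc-injective (trans (sym e) (solve 2 (λ j k → j :+ k :+ (con 1 :+ (j :+ k)) := con 1 :+ (j :+ j :+ (k :+ k))) refl j k))) refl))

  swaps-decompose : ∀ j k ι → length ι ≡ suc (j + k) + suc (j + k) → AvInv ι → Swaps (suc (j + k)) ι →
           at ι (j + k + suc (j + k)) ≡ j →
           Σ (List ℕ) λ β1 → Σ (List ℕ) λ τ → length β1 ≡ j + j × Swaps j β1 × AvInv β1 ×
             length τ ≡ k + k × Swaps k τ × AvInv τ × ι ≡ frame j (k + k) β1 τ
  swaps-decompose j k ι lι gι sw lst with Decompose.result {j + k + suc (j + k)} {j} {ι} lι gι lst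
                                     (≤-trans (s≤s (m≤m+n j k)) (m≤n+m (suc (j + k)) (j + k)))
  ... | s' , ns , β1 , τ , l1 , lτ , sw₁ , g1 , gτ , eq with frameSwaps-gap j k s' ns
  ... | refl = β1 , τ , l1 , sw₁ , g1 , lτ , FrameOfSwaps.Bwd.inner-swaps {j} {k} {β1} {τ} l1 sw₁ lτ gτ (subst (Swaps (suc (j + k))) eq sw) , gτ , eq

  swaps-lastValue≤ : ∀ n ι → length ι ≡ suc n + suc n → Swaps (suc n) ι → lastValue ι ≤ n
  swaps-lastValue≤ n ι lι sw = ≤-pred (subst (_< suc n) (trans (cong (at ι) (+-comm (suc n) n)) (sym (lastValue-at {ι} lι)))
                                  (swaps-upper {suc n} {ι} lι sw (n<1+n n)))

  wordList : ∀ {n k} → Vec (Fin n) k → List ℕ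
  wordList [] = []
  wordList (x ∷ xs) = toℕ x ∷ wordList xs

  length-wordList : ∀ {n k} (w : Vec (Fin n) k) → length (wordList w) ≡ k
  length-wordList [] = refl
  length-wordList (x ∷ w) = cong suc (length-wordList w)

  at-wordList : ∀ {n k} (w : Vec (Fin n) k) (i : Fin k) → at (wordList w) (toℕ i) ≡ toℕ (lookup w i)
  at-wordList (x ∷ w) F.zero = refl
  at-wordList (x ∷ w) (F.suc i) = at-wordList w i

  wordList-injective : ∀ {n k} {w w' : Vec (Fin n) k} → wordList w ≡ wordList w' → w ≡ w'
  wordList-injective {w = []} {[]} e = refl
  wordList-injective {w = x ∷ w} {y ∷ w'} e with LP.∷-injective e
  ... | e1 , e2 = cong₂ _∷_ (FP.toℕ-injective e1) (wordList-injective e2)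

  wordList-bounded : ∀ {n k} (w : Vec (Fin n) k) → All (_< n) (wordList w)
  wordList-bounded [] = []
  wordList-bounded (x ∷ w) = FP.toℕ<n x ∷ wordList-bounded w

  fromList : ∀ {n} (l : List ℕ) → All (_< n) l → Vec (Fin n) (length l)
  fromList [] [] = []
  fromList (x ∷ l) (p ∷ ps) = fromℕ< p ∷ fromList l ps

  wordList-fromList : ∀ {n} (l : List ℕ) (ps : All (_< n) l) → wordList (fromList l ps) ≡ l
  wordList-fromList [] [] = refl
  wordList-fromList (x ∷ l) (p ∷ ps) = cong₂ _∷_ (FP.toℕ-fromℕ< p) (wordList-fromList l ps)

  allB-elim : ∀ {A : Set} (p : A → Bool) xs → foldr (λ i b → p i ∧ b) true xs ≡ true → ∀ {i} → i ∈ xs → p i ≡ true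
  allB-elim p (x ∷ xs) e (here refl) with p x
  ... | true = refl
  ... | false = e
  allB-elim p (x ∷ xs) e (there m) with p x
  ... | true = allB-elim p xs e m
  ... | false = ⊥-elim (false≢true e)
    where false≢true : false ≡ true → ⊥
          false≢true ()

  allB-intro : ∀ {A : Set} (p : A → Bool) xs → (∀ i → p i ≡ true) → foldr (λ i b → p i ∧ b) true xs ≡ true
  allB-intro p [] f = refl
  allB-intro p (x ∷ xs) f rewrite f x = allB-intro p xs f

  anyB-elim : ∀ {A : Set} (p : A → Bool) xs → foldr (λ i b → if p i then true else b) false xs ≡ false → ∀ {i} → i ∈ xs → p i ≡ false
  anyB-elim p (x ∷ xs) e (here refl) with p x
  ... | true = e
  ... | false = refl
  anyB-elim p (x ∷ xs) e (there m) with p x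
  ... | true = ⊥-elim (t≢f e)
    where t≢f : true ≡ false → ⊥
          t≢f ()
  ... | false = anyB-elim p xs e m

  anyB-intro : ∀ {A : Set} (p : A → Bool) xs → (∀ i → p i ≡ false) → foldr (λ i b → if p i then true else b) false xs ≡ false
  anyB-intro p [] f = refl
  anyB-intro p (x ∷ xs) f rewrite f x = anyB-intro p xs f

  allF-elim : ∀ {n} (p : Fin n → Bool) → allF p ≡ true → ∀ i → p i ≡ true
  allF-elim {n} p e i = allB-elim p (allFin n) e (∈-allFin i)

  allF-intro : ∀ {n} (p : Fin n → Bool) → (∀ i → p i ≡ true) → allF p ≡ true
  allF-intro {n} p f = allB-intro p (allFin n) f

  anyF-elim : ∀ {n} (p : Fin n → Bool) → anyF p ≡ false → ∀ i → p i ≡ false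
  anyF-elim {n} p e i = anyB-elim p (allFin n) e (∈-allFin i)

  anyF-intro : ∀ {n} (p : Fin n → Bool) → (∀ i → p i ≡ false) → anyF p ≡ false
  anyF-intro {n} p f = anyB-intro p (allFin n) f

  ∧-true : ∀ {a b} → a ∧ b ≡ true → a ≡ true × b ≡ true
  ∧-true {true} {true} e = refl , refl

  not-true→false : ∀ {b} → (b ≡ true → ⊥) → b ≡ false
  not-true→false {true} f = ⊥-elim (f refl)
  not-true→false {false} f = refl

  <F⇒< : ∀ {n} {i j : Fin n} → (i <F j) ≡ true → toℕ i < toℕ j
  <F⇒< {i = i} {j} e with toℕ i <? toℕ j
  ... | yes p = p

  <⇒<F : ∀ {n} {i j : Fin n} → toℕ i < toℕ j → (i <F j) ≡ true
  <⇒<F {i = i} {j} p with toℕ i <? toℕ j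
  ... | yes _ = refl
  ... | no np = ⊥-elim (np p)

  ≟-true⇒≡ : ∀ {n} {x y : Fin n} → ⌊ x FP.≟ y ⌋ ≡ true → x ≡ y
  ≟-true⇒≡ {x = x} {y} e with x FP.≟ y
  ... | yes p = p

  ≡⇒≟-true : ∀ {n} {x y : Fin n} → x ≡ y → ⌊ x FP.≟ y ⌋ ≡ true
  ≡⇒≟-true {x = x} {y} p with x FP.≟ y
  ... | yes _ = refl
  ... | no np = ⊥-elim (np p)

  module WordBridge {n : ℕ} (w : Word n) where
    l : List ℕ
    l = wordList w

    lenl : length l ≡ n
    lenl = length-wordList w

    atl : ∀ (i : Fin n) → at l (toℕ i) ≡ toℕ (lookup w i)
    atl = at-wordList w

    fin : ∀ {i} → i < length l → Fin n
    fin p = fromℕ< (subst (_ <_) lenl p)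

    tofin : ∀ {i} (p : i < length l) → toℕ (fin p) ≡ i
    tofin p = FP.toℕ-fromℕ< _

    atfin : ∀ {i} (p : i < length l) → at l i ≡ toℕ (lookup w (fin p))
    atfin p = trans (cong (at l) (sym (tofin p))) (atl (fin p))

    inRange : InRange l
    inRange = subst (λ z → All (_< z) l) (sym lenl) (wordList-bounded w)

    involutive : isInvolution w ≡ true → Involutive l
    involutive e i p = trans (cong (at l) (atfin p)) (trans (atl (lookup w (fin p)))
                   (trans (cong toℕ (≟-true⇒≡ (allF-elim _ e (fin p)))) (tofin p)))

    isInvolution≡true : Involutive l → isInvolution w ≡ true
    isInvolution≡true iv = allF-intro _ λ i → ≡⇒≟-true (FP.toℕ-injective
      (trans (sym (atl (lookup w i))) (trans (cong (at l) (sym (atl i)))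
        (iv (toℕ i) (subst (toℕ i <_) (sym lenl) (FP.toℕ<n i))))))

    avoids : contains132 w ≡ false → Avoids132 l
    avoids e {i} {j} {k} ij jk kl p q =
      t≢f (trans (sym conj) (anyF-elim _ (anyF-elim _ (anyF-elim _ e fi) fj) fk))
      where
      t≢f : true ≡ false → ⊥
      t≢f ()
      il = <-trans ij (<-trans jk kl)
      jl = <-trans jk kl
      fi = fin il
      fj = fin jl
      fk = fin kl
      conj : ((fi <F fj) ∧ (fj <F fk) ∧ (lookup w fi <F lookup w fk) ∧ (lookup w fk <F lookup w fj)) ≡ true
      conj rewrite <⇒<F {i = fi} {fj} (subst₂ _<_ (sym (tofin il)) (sym (tofin jl)) ij)
                 | <⇒<F {i = fj} {fk} (subst₂ _<_ (sym (tofin jl)) (sym (tofin kl)) jk)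
                 | <⇒<F {i = lookup w fi} {lookup w fk} (subst₂ _<_ (atfin il) (atfin kl) p)
                 | <⇒<F {i = lookup w fk} {lookup w fj} (subst₂ _<_ (atfin kl) (atfin jl) q) = refl

    contains132≡false : Avoids132 l → contains132 w ≡ false
    contains132≡false av = anyF-intro _ λ i → anyF-intro _ λ j → anyF-intro _ λ k → not-true→false λ e →
      let e1 , e' = ∧-true e
          e2 , e'' = ∧-true e'
          e3 , e4 = ∧-true e''
          ln : ∀ (x : Fin n) → toℕ x < length l
          ln x = subst (toℕ x <_) (sym lenl) (FP.toℕ<n x)
      in av (<F⇒< e1) (<F⇒< e2) (ln k)
            (subst₂ _<_ (sym (atl i)) (sym (atl k)) (<F⇒< e3))
            (subst₂ _<_ (sym (atl k)) (sym (atl j)) (<F⇒< e4))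

  allVecs-complete : ∀ m n (w : Vec (Fin n) m) → w ∈ allVecs m n
  allVecs-complete zero n [] = here refl
  allVecs-complete (suc m) n (a ∷ w) = ∈-concatMap⁺ (λ a → map (a ∷_) (allVecs m n)) (lose (∈-allFin a) (∈-map⁺ (a ∷_) (allVecs-complete m n w)))

  allVecs-unique : ∀ m n → Unique (allVecs m n)
  allVecs-unique zero n = [] ∷ []
  allVecs-unique (suc m) n = UP.concat⁺ (AllP.map⁺ (All.universal (λ a → UP.map⁺ VP.∷-injectiveʳ (allVecs-unique m n)) (allFin n)))
    (AP.map⁺ (AllPairs.map (λ {a} {b} a≢b {v} (p , q) → a≢b (hd p q)) (UP.allFin⁺ n)))
    where
    hd : ∀ {a b : Fin n} {v} → v ∈ map (a ∷_) (allVecs m n) → v ∈ map (b ∷_) (allVecs m n) → a ≡ b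
    hd p q with ∈-map⁻ (_ ∷_) p | ∈-map⁻ (_ ∷_) q
    ... | x , _ , refl | y , _ , e = VP.∷-injectiveˡ e

  -- the decision procedure filtering allVecs in the definition of I132
  isAvInvWord? : ∀ N (σ : Word N) → Dec ((isInvolution σ ∧ not (contains132 σ)) ≡ true)
  isAvInvWord? N σ = isInvolution σ ∧ not (contains132 σ) Data.Bool.≟ true

  Involutions132 : ℕ → List (List ℕ)
  Involutions132 N = map wordList (I132 N)

  Involutions132-unique : ∀ N → Unique (Involutions132 N)
  Involutions132-unique N = UP.map⁺ wordList-injective (UP.filter⁺ _ (allVecs-unique N N))

  ∧-intro : ∀ {a b} → a ≡ true → b ≡ true → a ∧ b ≡ true
  ∧-intro refl refl = refl

  not-false : ∀ {b} → b ≡ false → not b ≡ true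
  not-false refl = refl

  not-true : ∀ {b} → not b ≡ true → b ≡ false
  not-true {false} _ = refl

  ∈Involutions132⇒ : ∀ {N l} → l ∈ Involutions132 N → length l ≡ N × AvInv l
  ∈Involutions132⇒ {N} m with ∈-map⁻ wordList m
  ... | w , wm , refl with ∈-filter⁻ (isAvInvWord? N) {xs = allVecs N N} wm
  ... | _ , e with ∧-true e
  ... | e1 , e2 = length-wordList w , WordBridge.inRange w , WordBridge.involutive w e1 , WordBridge.avoids w (not-true e2)

  ∈Involutions132⇐ : ∀ {N l} → length l ≡ N → AvInv l → l ∈ Involutions132 N
  ∈Involutions132⇐ {N} {l} refl (b , iv , av) =
    subst (_∈ Involutions132 (length l)) eqw (∈-map⁺ wordList (∈-filter⁺ (isAvInvWord? (length l)) (allVecs-complete _ _ w) P))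
    where
    w : Word (length l)
    w = fromList l b
    eqw : wordList w ≡ l
    eqw = wordList-fromList l b
    P : (isInvolution w ∧ not (contains132 w)) ≡ true
    P = ∧-intro (WordBridge.isInvolution≡true w (subst Involutive (sym eqw) iv)) (not-false (WordBridge.contains132≡false w (subst Avoids132 (sym eqw) av)))

  bit : Bool → ℕ
  bit b = if b then 1 else 0

  countTrue : ∀ {A : Set} → (A → Bool) → List A → ℕ
  countTrue p [] = 0
  countTrue p (x ∷ xs) = bit (p x) + countTrue p xs

  sumℕ : ∀ {A : Set} → (A → ℕ) → List A → ℕ
  sumℕ h [] = 0
  sumℕ h (x ∷ xs) = h x + sumℕ h xs

  length-filter : ∀ {A : Set} (p : A → Bool) xs → length (filter (λ x → p x Data.Bool.≟ true) xs) ≡ countTrue p xs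
  length-filter p [] = refl
  length-filter p (x ∷ xs) with p x
  ... | true = cong suc (length-filter p xs)
  ... | false = length-filter p xs

  countTrue-++ : ∀ {A : Set} (p : A → Bool) xs ys → countTrue p (xs ++ ys) ≡ countTrue p xs + countTrue p ys
  countTrue-++ p [] ys = refl
  countTrue-++ p (x ∷ xs) ys = trans (cong (bit (p x) +_) (countTrue-++ p xs ys)) (sym (+-assoc (bit (p x)) _ _))

  countTrue-concatMap : ∀ {A B : Set} (p : B → Bool) (f : A → List B) xs → countTrue p (concatMap f xs) ≡ sumℕ (countTrue p ∘ f) xs
  countTrue-concatMap p f [] = refl
  countTrue-concatMap p f (x ∷ xs) = trans (countTrue-++ p (f x) (concatMap f xs)) (cong (countTrue p (f x) +_) (countTrue-concatMap p f xs))

  countTrue-map : ∀ {A B : Set} (p : B → Bool) (g : A → B) xs → countTrue p (map g xs) ≡ countTrue (p ∘ g) xs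
  countTrue-map p g [] = refl
  countTrue-map p g (x ∷ xs) = cong (bit (p (g x)) +_) (countTrue-map p g xs)

  countRange : (ℕ → Bool) → ℕ → ℕ
  countRange q zero = 0
  countRange q (suc n) = bit (q 0) + countRange (q ∘ suc) n

  sumRange : (ℕ → ℕ) → ℕ → ℕ
  sumRange h zero = 0
  sumRange h (suc n) = h 0 + sumRange (h ∘ suc) n

  countTrue-tabulate : ∀ {A : Set} n (g : Fin n → A) (p : A → Bool) (q : ℕ → Bool) → (∀ i → p (g i) ≡ q (toℕ i)) → countTrue p (tabulate g) ≡ countRange q n
  countTrue-tabulate zero g p q e = refl
  countTrue-tabulate (suc n) g p q e = cong₂ _+_ (cong bit (e F.zero)) (countTrue-tabulate n (g ∘ F.suc) p (q ∘ suc) (λ i → e (F.suc i)))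

  sumℕ-tabulate : ∀ {A : Set} n (g : Fin n → A) (h : A → ℕ) (h' : ℕ → ℕ) → (∀ i → h (g i) ≡ h' (toℕ i)) → sumℕ h (tabulate g) ≡ sumRange h' n
  sumℕ-tabulate zero g h h' e = refl
  sumℕ-tabulate (suc n) g h h' e = cong₂ _+_ (e F.zero) (sumℕ-tabulate n (g ∘ F.suc) h (h' ∘ suc) (λ i → e (F.suc i)))

  <?≡<ᵇ : ∀ i j → ⌊ i <? j ⌋ ≡ (i <ᵇ j)
  <?≡<ᵇ i j with i <? j
  ... | yes p = sym (<⇒<ᵇ≡true p)
  ... | no np = sym (≥⇒<ᵇ≡false (≮⇒≥ np))

  countRange-countAbove : ∀ x xs → countRange (λ j → x <ᵇ at xs j) (length xs) ≡ countAbove x xs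
  countRange-countAbove x [] = refl
  countRange-countAbove x (y ∷ ys) = cong (isAbove x y +_) (countRange-countAbove x ys)

  coinvRange : List ℕ → ℕ → ℕ
  coinvRange l N = sumRange (λ i → countRange (λ j → (i <ᵇ j) ∧ (at l i <ᵇ at l j)) N) N

  coinvRange-length : ∀ l → coinvRange l (length l) ≡ coinvList l
  coinvRange-length [] = refl
  coinvRange-length (x ∷ xs) = cong₂ _+_ (countRange-countAbove x xs) (coinvRange-length xs)

  coinv-bridge : ∀ {n} (σ : Word n) → coinv σ ≡ coinvList (wordList σ)
  coinv-bridge {n} σ = begin
    coinv σ ≡⟨ length-filter D (concatMap (λ i → map (i ,_) (allFin n)) (allFin n)) ⟩
    countTrue D (concatMap (λ i → map (i ,_) (allFin n)) (allFin n)) ≡⟨ countTrue-concatMap D _ (allFin n) ⟩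
    sumℕ (λ i → countTrue D (map (i ,_) (allFin n))) (allFin n) ≡⟨ sumℕ-tabulate n (λ i → i) _ (λ i → countRange (λ j → (i <ᵇ j) ∧ (at lσ i <ᵇ at lσ j)) n)
         (λ i → trans (countTrue-map D (i ,_) (allFin n)) (countTrue-tabulate n (λ j → j) _ _ (λ j → cong₂ _∧_ (<?≡<ᵇ (toℕ i) (toℕ j))
            (trans (<?≡<ᵇ _ _) (sym (cong₂ _<ᵇ_ (at-wordList σ i) (at-wordList σ j))))))) ⟩
    coinvRange lσ n ≡⟨ cong (coinvRange lσ) (sym (length-wordList σ)) ⟩
    coinvRange lσ (length lσ) ≡⟨ coinvRange-length lσ ⟩
    coinvList lσ ∎
    where
    open ≡-Reasoning
    lσ = wordList σ
    D : Fin n × Fin n → Bool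
    D p = (proj₁ p <F proj₂ p) ∧ (lookup σ (proj₁ p) <F lookup σ (proj₂ p))

  unique-map-injectiveOn : ∀ {A B : Set} (F : B → A) (M : List B) → Unique M →
               (∀ {x y} → x ∈ M → y ∈ M → F x ≡ F y → x ≡ y) → Unique (map F M)
  unique-map-injectiveOn F [] u inj = []
  unique-map-injectiveOn F (x ∷ M) (px ∷ u) inj =
    AllP.map⁺ (All.tabulate (λ {y} ym e → All.lookup px ym (inj (here refl) (there ym) e)))
    ∷ unique-map-injectiveOn F M u (λ a b e → inj (there a) (there b) e)

  ↭-image : ∀ {A B : Set} (F : B → A) (M : List B) (L : List A) → Unique M → Unique L →
            (∀ {x y} → x ∈ M → y ∈ M → F x ≡ F y → x ≡ y) →
            (∀ {b} → b ∈ M → F b ∈ L) →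
            (∀ {a} → a ∈ L → Σ B (λ b → b ∈ M × F b ≡ a)) → L ↭ map F M
  ↭-image F M L uM uL inj into onto = ∼bag⇒↭ (unique∧set⇒bag uL (unique-map-injectiveOn F M uM inj)
    (mk⇔ (λ aL → let b , bM , e = onto aL in subst (_∈ map F M) e (∈-map⁺ F bM))
         (λ aFM → let b , bM , e = ∈-map⁻ F aFM in subst (_∈ L) (sym e) (into bM))))

  ↭-partition : ∀ {A : Set} (key : A → ℕ) (L : List A) (K : List ℕ) → Unique L → Unique K →
                (∀ {x} → x ∈ L → key x ∈ K) →
                L ↭ concatMap (λ v → filter (λ x → key x ≟ v) L) K
  ↭-partition key L K uL uK inK = ∼bag⇒↭ (unique∧set⇒bag uL uBlocks
    (mk⇔ (λ xL → ∈-concatMap⁺ block (Any.map (λ { refl → ∈-filter⁺ (λ x → key x ≟ _) xL refl }) (inK xL)))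
         (λ xR → let v , xb = Any.satisfied (∈-concatMap⁻ block {xs = K} xR) in
                   proj₁ (∈-filter⁻ (λ x → key x ≟ v) {xs = L} xb))))
    where
    block = λ v → filter (λ x → key x ≟ v) L
    uBlocks : Unique (concatMap block K)
    uBlocks = UP.concat⁺ (AllP.map⁺ (All.universal (λ v → UP.filter⁺ (λ x → key x ≟ v) uL) K))
           (AP.map⁺ (AllPairs.map (λ {v} {w} v≢w {x} (p , q) →
              v≢w (trans (sym (proj₂ (∈-filter⁻ (λ x → key x ≟ v) {xs = L} p))) (proj₂ (∈-filter⁻ (λ x → key x ≟ w) {xs = L} q)))) uK))

  swaps? : ∀ m (β : List ℕ) → Dec (Swaps m β)
  swaps? m β = all? (λ x → (m ≤? x) ×-dec (x <? m + m)) (take m β) ×-dec all? (_<? m) (drop m β)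

  SwapInvolutions : ℕ → List (List ℕ)
  SwapInvolutions m = filter (swaps? m) (Involutions132 (m + m))

  SwapInvolutions-unique : ∀ m → Unique (SwapInvolutions m)
  SwapInvolutions-unique m = UP.filter⁺ (swaps? m) (Involutions132-unique (m + m))

  ∈SwapInvolutions⇒ : ∀ {m β} → β ∈ SwapInvolutions m → length β ≡ m + m × AvInv β × Swaps m β
  ∈SwapInvolutions⇒ {m} p with ∈-filter⁻ (swaps? m) {xs = Involutions132 (m + m)} p
  ... | q , sw = proj₁ (∈Involutions132⇒ q) , proj₂ (∈Involutions132⇒ q) , sw

  ∈SwapInvolutions⇐ : ∀ {m β} → length β ≡ m + m → AvInv β → Swaps m β → β ∈ SwapInvolutions m
  ∈SwapInvolutions⇐ {m} l g sw = ∈-filter⁺ (swaps? m) (∈Involutions132⇐ l g) sw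

  withLast : ℕ → List (List ℕ) → List (List ℕ)
  withLast v L = filter (λ x → lastValue x ≟ v) L

  frame′ : ℕ → ℕ → List ℕ × List ℕ → List ℕ
  frame′ m s p = frame m s (proj₁ p) (proj₂ p)

  frame′-injectiveOn : ∀ {m s} (M₁ M₂ : List (List ℕ)) → (∀ {β} → β ∈ M₁ → length β ≡ m + m) → (∀ {τ} → τ ∈ M₂ → length τ ≡ s) →
    ∀ {x y} → x ∈ cartesianProduct M₁ M₂ → y ∈ cartesianProduct M₁ M₂ → frame′ m s x ≡ frame′ m s y → x ≡ y
  frame′-injectiveOn {m} {s} M₁ M₂ len₁ len₂ mx my e with ∈-cartesianProduct⁻ M₁ M₂ mx | ∈-cartesianProduct⁻ M₁ M₂ my
  ... | a , b | c , d with frame-injective {m} {s} (len₁ a) (len₂ b) (len₁ c) (len₂ d) e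
  ... | r1 , r2 = cong₂ _,_ r1 r2

  withLast-fixed : ∀ n → withLast n (Involutions132 (suc n)) ↭ map (_++ [ n ]) (Involutions132 n)
  withLast-fixed n = ↭-image (_++ [ n ]) (Involutions132 n) (withLast n (Involutions132 (suc n)))
    (Involutions132-unique n) (UP.filter⁺ (λ x → lastValue x ≟ n) (Involutions132-unique (suc n)))
    (λ _ _ e → LP.++-cancelʳ _ _ _ e)
    (λ {τ} m → let lτ , gτ = ∈Involutions132⇒ {n} m in
       ∈-filter⁺ (λ x → lastValue x ≟ n) (∈Involutions132⇐ {suc n} (len {τ} lτ) (avInv-snoc-fixed lτ gτ))
                 (trans (lastValue-at {τ ++ [ n ]} (len {τ} lτ)) (atN {τ} lτ)))
    (λ {ι} m → let mι , kι = ∈-filter⁻ (λ x → lastValue x ≟ n) {xs = Involutions132 (suc n)} m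
                   lι , gι = ∈Involutions132⇒ {suc n} mι
                   τ , lτ , gτ , e = avInv-unsnoc-fixed lι gι (trans (sym (lastValue-at {ι} lι)) kι) in
               τ , ∈Involutions132⇐ {n} lτ gτ , sym e)
    where
    len : ∀ {τ} → length τ ≡ n → length (τ ++ [ n ]) ≡ suc n
    len {τ} lτ = trans (LP.length-++ τ) (trans (cong (_+ 1) lτ) (+-comm n 1))
    atN : ∀ {τ} → length τ ≡ n → at (τ ++ [ n ]) n ≡ n
    atN {τ} lτ = trans (cong (at (τ ++ [ n ])) (sym (+-identityʳ n))) (at-++ʳ τ [ n ] lτ 0)

  frameTop-injective : ∀ {v s s'} → frameTop v s ≡ frameTop v s' → s ≡ s'
  frameTop-injective {v} {s} {s'} e = +-cancelˡ-≡ v _ _ (+-cancelʳ-≡ v _ _ (suc-injective e))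

  withLast-frame : ∀ n v s → n ≡ frameTop v s →
           withLast v (Involutions132 (suc n)) ↭ map (frame′ v s) (cartesianProduct (SwapInvolutions v) (Involutions132 s))
  withLast-frame n v s ns = ↭-image (frame′ v s) (cartesianProduct (SwapInvolutions v) (Involutions132 s)) (withLast v (Involutions132 (suc n)))
    (UP.cartesianProduct⁺ (SwapInvolutions-unique v) (Involutions132-unique s)) (UP.filter⁺ (λ x → lastValue x ≟ v) (Involutions132-unique (suc n)))
    (frame′-injectiveOn {v} {s} (SwapInvolutions v) (Involutions132 s) (λ a → proj₁ (∈SwapInvolutions⇒ {v} a)) (λ b → proj₁ (∈Involutions132⇒ {s} b)))
    (λ {p} m → let a , b = ∈-cartesianProduct⁻ (SwapInvolutions v) (Involutions132 s) m
                   lβ , gβ , sw = ∈SwapInvolutions⇒ {v} a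
                   lτ , gτ = ∈Involutions132⇒ {s} b
                   lf , gf , kf = frame-avInv {v} {s} lβ sw gβ lτ gτ in
               ∈-filter⁺ (λ x → lastValue x ≟ v) (∈Involutions132⇐ {suc n} (trans lf (cong suc (sym ns))) gf) kf)
    (λ {ι} m → let mι , kι = ∈-filter⁻ (λ x → lastValue x ≟ v) {xs = Involutions132 (suc n)} m
                   lι , gι = ∈Involutions132⇒ {suc n} mι
                   lst = trans (sym (lastValue-at {ι} lι)) kι
                   vn : v < n
                   vn = subst (v <_) (sym ns) (s≤s (≤-trans (m≤m+n v s) (m≤m+n (v + s) v)))
               in go ι lι gι lst (Decompose.result {n} {v} {ι} lι gι lst vn))
    where
    go : ∀ ι → length ι ≡ suc n → AvInv ι → at ι n ≡ v →
         (Σ ℕ λ s' → (n ≡ frameTop v s') × Σ (List ℕ) λ β' → Σ (List ℕ) λ τ' →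
             length β' ≡ v + v × length τ' ≡ s' × Swaps v β' × AvInv β' × AvInv τ' × ι ≡ frame v s' β' τ') →
         Σ (List ℕ × List ℕ) λ p → p ∈ cartesianProduct (SwapInvolutions v) (Involutions132 s) × frame′ v s p ≡ ι
    go ι lι gι lst (s' , ns' , β , τ , lβ , lτ , sw , gβ , gτ , eq) with frameTop-injective {v} {s} {s'} (trans (sym ns) ns')
    ... | refl = (β , τ) , ∈-cartesianProduct⁺ (∈SwapInvolutions⇐ {v} lβ gβ sw) (∈Involutions132⇐ {s} lτ gτ) , sym eq

  withLast-swaps : ∀ j k → withLast j (SwapInvolutions (suc (j + k))) ↭ map (frame′ j (k + k)) (cartesianProduct (SwapInvolutions j) (SwapInvolutions k))
  withLast-swaps j k = ↭-image (frame′ j (k + k)) (cartesianProduct (SwapInvolutions j) (SwapInvolutions k)) (withLast j (SwapInvolutions M))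
    (UP.cartesianProduct⁺ (SwapInvolutions-unique j) (SwapInvolutions-unique k)) (UP.filter⁺ (λ x → lastValue x ≟ j) (SwapInvolutions-unique M))
    (frame′-injectiveOn {j} {k + k} (SwapInvolutions j) (SwapInvolutions k) (λ a → proj₁ (∈SwapInvolutions⇒ {j} a)) (λ b → proj₁ (∈SwapInvolutions⇒ {k} b)))
    (λ {p} m → let a , b = ∈-cartesianProduct⁻ (SwapInvolutions j) (SwapInvolutions k) m
                   l1 , g1 , sw₁ = ∈SwapInvolutions⇒ {j} a
                   l2 , g2 , sw₂ = ∈SwapInvolutions⇒ {k} b
                   lf , gf , swf , kf = frame-of-swaps {j} {k} l1 sw₁ g1 l2 sw₂ g2 in
               ∈-filter⁺ (λ x → lastValue x ≟ j) (∈SwapInvolutions⇐ {M} lf gf swf) kf)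
    (λ {ι} m → let mι , kι = ∈-filter⁻ (λ x → lastValue x ≟ j) {xs = SwapInvolutions M} m
                   lι , gι , swι = ∈SwapInvolutions⇒ {M} mι
                   lst = trans (sym (lastValue-at {ι} lι)) kι
                   β1 , τ , l1 , sw₁ , g1 , lτ , swτ , gτ , eq = swaps-decompose j k ι lι gι swι lst in
               (β1 , τ) , ∈-cartesianProduct⁺ (∈SwapInvolutions⇐ {j} l1 g1 sw₁) (∈SwapInvolutions⇐ {k} lτ gτ swτ) , sym eq)
    where M = suc (j + k)


  -- Halving arithmetic: the last values v < n of involutions of [n+1] are exactly
  -- the v < ⌊(n+1)/2⌋, with n = frameTop v (n+1 - 2(v+1)).
  frameTop-double : ∀ v s → 2 * suc v + s ≡ suc (frameTop v s)
  frameTop-double = solve 2 (λ v s → con 2 :* (con 1 :+ v) :+ s := con 2 :+ (v :+ s :+ v)) refl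

  half⇒frameTop : ∀ n v → v < suc n / 2 → n ≡ frameTop v (suc n ∸ 2 * suc v)
  half⇒frameTop n v p = suc-injective (trans (sym (m+[n∸m]≡n le)) (frameTop-double v _))
    where
    le : 2 * suc v ≤ suc n
    le = subst (_≤ suc n) (*-comm (suc v) 2) (≤-trans (*-mono-≤ p (≤-refl {2})) (m/n*n≤m (suc n) 2))

  frameTop⇒half : ∀ n v s → n ≡ frameTop v s → v < suc n / 2
  frameTop⇒half n v s e = subst (_≤ suc n / 2) (m*n/n≡m (suc v) 2) (/-monoˡ-≤ 2 le)
    where
    le : suc v * 2 ≤ suc n
    le = subst (_≤ suc n) (*-comm 2 (suc v)) (subst (2 * suc v ≤_) (trans (frameTop-double v s) (cong suc (sym e))) (m≤m+n _ s))

  half≤ : ∀ n → suc n / 2 ≤ n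
  half≤ n = ≤-pred (m<n*o⇒m/o<n (m<m*n (suc n) 2 (s≤s (s≤s z≤n))))

  lastValues-unique : ∀ n → Unique (n ∷ upTo (suc n / 2))
  lastValues-unique n = All.tabulate (λ {y} ym e → <-irrefl (sym e) (<-≤-trans (∈-upTo⁻ ym) (half≤ n))) ∷ UP.upTo⁺ _

  lastValue-involution : ∀ n {x} → x ∈ Involutions132 (suc n) → lastValue x ∈ (n ∷ upTo (suc n / 2))
  lastValue-involution n {x} x∈ with ∈Involutions132⇒ {suc n} x∈
  ... | lx , gx with lastValue x ≟ n
  ...   | yes e = here e
  ...   | no ne = there (∈-upTo⁺ (frameTop⇒half n (lastValue x) (proj₁ r) (proj₁ (proj₂ r))))
    where
    lst : at x n ≡ lastValue x
    lst = sym (lastValue-at {x} lx)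
    last<n : lastValue x < n
    last<n with m≤n⇒m<n∨m≡n (≤-pred (subst (_< suc n) lst (subst (at x n <_) lx (All-at (proj₁ gx) (subst (n <_) (sym lx) (n<1+n n))))))
    ... | inj₁ p = p
    ... | inj₂ e = ⊥-elim (ne e)
    r = Decompose.result {n} {lastValue x} {x} lx gx lst last<n

  lastValue-swaps : ∀ n {x} → x ∈ SwapInvolutions (suc n) → lastValue x ∈ upTo (suc n)
  lastValue-swaps n {x} x∈ with ∈SwapInvolutions⇒ {suc n} x∈
  ... | lx , gx , sw = ∈-upTo⁺ (s≤s (swaps-lastValue≤ n x lx sw))

module GeneratingFunctions {c ℓ : Level} (S : CommutativeSemiring c ℓ) where

  open CommutativeSemiring S renaming (_*_ to _·_)
  open import Relation.Binary.Reasoning.Setoid setoid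
  open Combinatorics

  sumOver : ∀ {A : Set} → (A → Carrier) → List A → Carrier
  sumOver f xs = sumS S (map f xs)

  sum-↭ : ∀ {xs ys : List Carrier} → xs ↭ ys → sumS S xs ≈ sumS S ys
  sum-↭ ↭.refl = refl
  sum-↭ (↭.prep x p) = +-congˡ (sum-↭ p)
  sum-↭ (↭.swap {xs} {ys} x y p) = begin
    x + (y + sumS S xs) ≈⟨ +-assoc x y _ ⟨
    (x + y) + sumS S xs ≈⟨ +-cong (+-comm x y) (sum-↭ p) ⟩
    (y + x) + sumS S ys ≈⟨ +-assoc y x _ ⟩
    y + (x + sumS S ys) ∎
  sum-↭ (↭.trans p p′) = trans (sum-↭ p) (sum-↭ p′)

  sumOver-↭ : ∀ {A : Set} (f : A → Carrier) {xs ys} → xs ↭ ys → sumOver f xs ≈ sumOver f ys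
  sumOver-↭ f p = sum-↭ (↭ₚ.map⁺ f p)

  sumOver-++ : ∀ {A : Set} (f : A → Carrier) xs ys → sumOver f (xs ++ ys) ≈ sumOver f xs + sumOver f ys
  sumOver-++ f [] ys = sym (+-identityˡ _)
  sumOver-++ f (x ∷ xs) ys = trans (+-congˡ (sumOver-++ f xs ys)) (sym (+-assoc _ _ _))

  sumOver-concatMap : ∀ {A B : Set} (f : B → Carrier) (g : A → List B) xs →
                      sumOver f (concatMap g xs) ≈ sumOver (λ x → sumOver f (g x)) xs
  sumOver-concatMap f g [] = refl
  sumOver-concatMap f g (x ∷ xs) = trans (sumOver-++ f (g x) (concatMap g xs)) (+-congˡ (sumOver-concatMap f g xs))

  sumOver-map : ∀ {A B : Set} (f : B → Carrier) (g : A → B) xs → sumOver f (map g xs) ≈ sumOver (λ x → f (g x)) xs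
  sumOver-map f g xs = reflexive (Eq.cong (sumS S) (Eq.sym (LP.map-∘ xs)))

  sumOver-cong : ∀ {A : Set} {f g : A → Carrier} (xs : List A) → (∀ {x} → x ∈ xs → f x ≈ g x) → sumOver f xs ≈ sumOver g xs
  sumOver-cong [] h = refl
  sumOver-cong (x ∷ xs) h = +-cong (h (here Eq.refl)) (sumOver-cong xs (λ m → h (there m)))

  sumOver-·ˡ : ∀ {A : Set} (a : Carrier) (f : A → Carrier) xs → sumOver (λ x → a · f x) xs ≈ a · sumOver f xs
  sumOver-·ˡ a f [] = sym (zeroʳ a)
  sumOver-·ˡ a f (x ∷ xs) = trans (+-congˡ (sumOver-·ˡ a f xs)) (sym (distribˡ a _ _))

  sumOver-cartesianProduct : ∀ {A B : Set} (f : A → Carrier) (g : B → Carrier) xs ys →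
    sumOver (λ p → f (proj₁ p) · g (proj₂ p)) (cartesianProduct xs ys) ≈ sumOver f xs · sumOver g ys
  sumOver-cartesianProduct f g [] ys = sym (zeroˡ _)
  sumOver-cartesianProduct f g (x ∷ xs) ys = begin
    sumOver h (map (x ,_) ys ++ cartesianProduct xs ys)
      ≈⟨ sumOver-++ h (map (x ,_) ys) (cartesianProduct xs ys) ⟩
    sumOver h (map (x ,_) ys) + sumOver h (cartesianProduct xs ys)
      ≈⟨ +-cong (trans (sumOver-map h (x ,_) ys) (sumOver-·ˡ (f x) g ys)) (sumOver-cartesianProduct f g xs ys) ⟩
    f x · sumOver g ys + sumOver f xs · sumOver g ys
      ≈⟨ distribʳ _ _ _ ⟨
    (f x + sumOver f xs) · sumOver g ys ∎
    where h = λ p → f (proj₁ p) · g (proj₂ p)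

  pow-+ : ∀ (x : Carrier) a b → pow S x (a ℕ.+ b) ≈ pow S x a · pow S x b
  pow-+ x zero b = sym (*-identityˡ _)
  pow-+ x (suc a) b = trans (*-congˡ (pow-+ x a b)) (sym (*-assoc _ _ _))

  pow-double : ∀ (x : Carrier) j → pow S x (j ℕ.+ j) ≈ pow S (x · x) j
  pow-double x zero = refl
  pow-double x (suc j) = begin
    x · pow S x (j ℕ.+ suc j)     ≈⟨ *-congˡ (reflexive (Eq.cong (pow S x) (NP.+-suc j j))) ⟩
    x · (x · pow S x (j ℕ.+ j))   ≈⟨ *-assoc _ _ _ ⟨
    (x · x) · pow S x (j ℕ.+ j)   ≈⟨ *-congˡ (pow-double x j) ⟩
    (x · x) · pow S (x · x) j     ∎

  module Weighted (q : Carrier) where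

    weight : List ℕ → Carrier
    weight l = pow S q (coinvList l)

    II : ℕ → Carrier
    II N = sumOver weight (Involutions132 N)

    CB : ℕ → Carrier
    CB m = sumOver weight (SwapInvolutions m)

    IIbar≈II : ∀ N → IIbar S q N ≈ II N
    IIbar≈II N = sym (trans (sumOver-map weight wordList (I132 N))
                   (sumOver-cong (I132 N) (λ {ι} _ → reflexive (Eq.cong (pow S q) (Eq.sym (coinv-bridge ι))))))

    weight-frame : ∀ {m s β τ} → length β ≡ m ℕ.+ m → length τ ≡ s → Swaps m β → InRange τ →
                   weight (frame m s β τ) ≈ pow S q (m ℕ.+ m) · (weight β · weight τ)
    weight-frame {m} {s} {β} {τ} lβ lτ sw rτ = begin
      pow S q (coinvList (frame m s β τ))                     ≡⟨ Eq.cong (pow S q) (coinv-frame lβ lτ sw rτ) ⟩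
      pow S q (m ℕ.+ m ℕ.+ (coinvList β ℕ.+ coinvList τ))     ≈⟨ pow-+ q (m ℕ.+ m) _ ⟩
      pow S q (m ℕ.+ m) · pow S q (coinvList β ℕ.+ coinvList τ) ≈⟨ *-congˡ (pow-+ q (coinvList β) (coinvList τ)) ⟩
      pow S q (m ℕ.+ m) · (weight β · weight τ)               ∎

    sum-along-frames : ∀ {L : List (List ℕ)} (M₁ M₂ : List (List ℕ)) (F : List ℕ × List ℕ → List ℕ) (a : Carrier) →
      L ↭ map F (cartesianProduct M₁ M₂) →
      (∀ {p} → p ∈ cartesianProduct M₁ M₂ → weight (F p) ≈ a · (weight (proj₁ p) · weight (proj₂ p))) →
      sumOver weight L ≈ a · (sumOver weight M₁ · sumOver weight M₂)
    sum-along-frames {L} M₁ M₂ F a L↭ wF = begin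
      sumOver weight L                                          ≈⟨ sumOver-↭ weight L↭ ⟩
      sumOver weight (map F cp)                                 ≈⟨ sumOver-map weight F cp ⟩
      sumOver (λ p → weight (F p)) cp                           ≈⟨ sumOver-cong cp wF ⟩
      sumOver (λ p → a · (weight (proj₁ p) · weight (proj₂ p))) cp ≈⟨ sumOver-·ˡ a _ cp ⟩
      a · sumOver (λ p → weight (proj₁ p) · weight (proj₂ p)) cp ≈⟨ *-congˡ (sumOver-cartesianProduct weight weight M₁ M₂) ⟩
      a · (sumOver weight M₁ · sumOver weight M₂)               ∎
      where cp = cartesianProduct M₁ M₂

    sum-fixedLast : ∀ n → sumOver weight (withLast n (Involutions132 (suc n))) ≈ pow S q n · II n
    sum-fixedLast n = begin
      sumOver weight (withLast n (Involutions132 (suc n)))    ≈⟨ sumOver-↭ weight (withLast-fixed n) ⟩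
      sumOver weight (map (_++ [ n ]) (Involutions132 n))     ≈⟨ sumOver-map weight (_++ [ n ]) (Involutions132 n) ⟩
      sumOver (λ τ → weight (τ ++ [ n ])) (Involutions132 n)  ≈⟨ sumOver-cong (Involutions132 n) weight-snoc ⟩
      sumOver (λ τ → pow S q n · weight τ) (Involutions132 n) ≈⟨ sumOver-·ˡ (pow S q n) weight (Involutions132 n) ⟩
      pow S q n · II n                                       ∎
      where
      weight-snoc : ∀ {τ} → τ ∈ Involutions132 n → weight (τ ++ [ n ]) ≈ pow S q n · weight τ
      weight-snoc {τ} m with ∈Involutions132⇒ {n} m
      ... | lτ , (rτ , _) = trans (reflexive (Eq.cong (pow S q) (coinv-snoc-fixed lτ rτ))) (pow-+ q n (coinvList τ))

    sum-frameLast : ∀ n v s → n ≡ frameTop v s →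
                    sumOver weight (withLast v (Involutions132 (suc n))) ≈ pow S q (v ℕ.+ v) · (CB v · II s)
    sum-frameLast n v s ns = sum-along-frames (SwapInvolutions v) (Involutions132 s) (frame′ v s) (pow S q (v ℕ.+ v)) (withLast-frame n v s ns) wF
      where
      wF : ∀ {p} → p ∈ cartesianProduct (SwapInvolutions v) (Involutions132 s) →
           weight (frame′ v s p) ≈ pow S q (v ℕ.+ v) · (weight (proj₁ p) · weight (proj₂ p))
      wF m with ∈-cartesianProduct⁻ (SwapInvolutions v) (Involutions132 s) m
      ... | a , b with ∈SwapInvolutions⇒ {v} a | ∈Involutions132⇒ {s} b
      ... | lβ , _ , sw | lτ , (rτ , _) = weight-frame lβ lτ sw rτ

    sum-swapsLast : ∀ n j k → j ℕ.+ k ≡ n →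
                    sumOver weight (withLast j (SwapInvolutions (suc n))) ≈ pow S q (j ℕ.+ j) · (CB j · CB k)
    sum-swapsLast .(j ℕ.+ k) j k Eq.refl = sum-along-frames (SwapInvolutions j) (SwapInvolutions k) (frame′ j (k ℕ.+ k)) (pow S q (j ℕ.+ j)) (withLast-swaps j k) wF
      where
      wF : ∀ {p} → p ∈ cartesianProduct (SwapInvolutions j) (SwapInvolutions k) →
           weight (frame′ j (k ℕ.+ k) p) ≈ pow S q (j ℕ.+ j) · (weight (proj₁ p) · weight (proj₂ p))
      wF m with ∈-cartesianProduct⁻ (SwapInvolutions j) (SwapInvolutions k) m
      ... | a , b with ∈SwapInvolutions⇒ {j} a | ∈SwapInvolutions⇒ {k} b
      ... | lβ , _ , sw | lτ , (rτ , _) , _ = weight-frame lβ lτ sw rτ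

    sumOver-byLast : ∀ (L : List (List ℕ)) (K : List ℕ) → Unique L → Unique K → (∀ {x} → x ∈ L → lastValue x ∈ K) →
                     sumOver weight L ≈ sumOver (λ v → sumOver weight (withLast v L)) K
    sumOver-byLast L K uL uK inK =
      trans (sumOver-↭ weight (↭-partition lastValue L K uL uK inK)) (sumOver-concatMap weight (λ v → withLast v L) K)

    II-byLast : ∀ n → II (suc n) ≈ sumOver weight (withLast n (Involutions132 (suc n)))
                                   + sumOver (λ v → sumOver weight (withLast v (Involutions132 (suc n)))) (upTo (suc n / 2))
    II-byLast n = sumOver-byLast (Involutions132 (suc n)) (n ∷ upTo (suc n / 2))
                    (Involutions132-unique (suc n)) (lastValues-unique n) (lastValue-involution n)

    CB-byLast : ∀ n → CB (suc n) ≈ sumOver (λ j → sumOver weight (withLast j (SwapInvolutions (suc n)))) (upTo (suc n))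
    CB-byLast n = sumOver-byLast (SwapInvolutions (suc n)) (upTo (suc n))
                    (SwapInvolutions-unique (suc n)) (UP.upTo⁺ (suc n)) (lastValue-swaps n)

    module _ (C : ℕ → Carrier → Carrier) (C-zero : ∀ x → C 0 x ≈ 1#)
             (C-suc : ∀ n x → C (suc n) x ≈ sumS S (map (λ k → pow S x k · (C k x · C (n ∸ k) x)) (upTo (suc n)))) where

      CB≈C : ∀ m → CB m ≈ C m (q · q)
      CB≈C m = bounded m m NP.≤-refl
        where
        -- strong induction on m, with the bound N as the decreasing measure
        bounded : ∀ N m → m ℕ.≤ N → CB m ≈ C m (q · q)
        bounded N zero _ = trans (+-identityʳ 1#) (sym (C-zero (q · q)))
        bounded (suc N) (suc n) (ℕ.s≤s m≤N) = begin
          CB (suc n)  ≈⟨ CB-byLast n ⟩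
          sumOver (λ j → sumOver weight (withLast j (SwapInvolutions (suc n)))) (upTo (suc n))
                      ≈⟨ sumOver-cong (upTo (suc n)) term ⟩
          sumOver (λ j → pow S (q · q) j · (C j (q · q) · C (n ∸ j) (q · q))) (upTo (suc n))
                      ≈⟨ C-suc n (q · q) ⟨
          C (suc n) (q · q) ∎
          where
          term : ∀ {j} → j ∈ upTo (suc n) →
                 sumOver weight (withLast j (SwapInvolutions (suc n))) ≈ pow S (q · q) j · (C j (q · q) · C (n ∸ j) (q · q))
          term {j} j∈ = trans (sum-swapsLast n j (n ∸ j) (NP.m+[n∸m]≡n j≤n))
            (*-cong (pow-double q j) (*-cong (bounded N j (NP.≤-trans j≤n m≤N)) (bounded N (n ∸ j) (NP.≤-trans (NP.m∸n≤m n j) m≤N))))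
            where
            j≤n : j ℕ.≤ n
            j≤n = NP.≤-pred (∈-upTo⁻ j∈)

      recurrence : ∀ n → IIbar S q (suc n) ≈
          pow S q n · IIbar S q n
          + sumS S (map (λ k → pow S q (2 * (k ∸ 1)) · (C (k ∸ 1) (q · q) · IIbar S q (suc n ∸ 2 * k)))
                        (map suc (upTo (suc n / 2))))
      recurrence n = begin
        IIbar S q (suc n)   ≈⟨ IIbar≈II (suc n) ⟩
        II (suc n)          ≈⟨ II-byLast n ⟩
        sumOver weight (withLast n (Involutions132 (suc n)))
          + sumOver (λ v → sumOver weight (withLast v (Involutions132 (suc n)))) (upTo (suc n / 2))
                            ≈⟨ +-cong (trans (sum-fixedLast n) (*-congˡ (sym (IIbar≈II n)))) (sumOver-cong (upTo (suc n / 2)) term) ⟩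
        pow S q n · IIbar S q n + sumOver (λ v → T (suc v)) (upTo (suc n / 2))
                            ≈⟨ +-congˡ (sumOver-map T suc (upTo (suc n / 2))) ⟨
        pow S q n · IIbar S q n + sumS S (map T (map suc (upTo (suc n / 2)))) ∎
        where
        T : ℕ → Carrier
        T k = pow S q (2 * (k ∸ 1)) · (C (k ∸ 1) (q · q) · IIbar S q (suc n ∸ 2 * k))
        term : ∀ {v} → v ∈ upTo (suc n / 2) → sumOver weight (withLast v (Involutions132 (suc n))) ≈ T (suc v)
        term {v} v∈ = trans (sum-frameLast n v s (half⇒frameTop n v (∈-upTo⁻ v∈)))
          (*-cong (reflexive (Eq.cong (λ e → pow S q (v ℕ.+ e)) (Eq.sym (NP.+-identityʳ v))))
                  (*-cong (CB≈C v) (sym (IIbar≈II s))))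
          where s = suc n ∸ 2 * suc v

open GeneratingFunctions using (module Weighted)

proposition3p10 : ∀ {c ℓ : Level} (S : CommutativeSemiring c ℓ) →
    let open CommutativeSemiring S renaming (_*_ to _·_) in
    (C : ℕ → Carrier → Carrier) →
    (∀ x → C 0 x ≈ 1#) →
    (∀ n x → C (suc n) x ≈ sumS S (map (λ k → pow S x k · (C k x · C (n ∸ k) x)) (upTo (suc n)))) →
    (q : Carrier) →
    (IIbar S q 0 ≈ 1#) ×
    (∀ n → IIbar S q (suc n) ≈
      pow S q n · IIbar S q n
      + sumS S (map (λ k → pow S q (2 * (k ∸ 1)) · (C (k ∸ 1) (q · q) · IIbar S q (suc n ∸ 2 * k)))
                    (map suc (upTo (suc n / 2)))))
-- I_0(132) consists of the empty word, so II_0 = q^0 + 0.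
proposition3p10 S C C-zero C-suc q =
  CommutativeSemiring.+-identityʳ S (CommutativeSemiring.1# S) ,
  Weighted.recurrence S q C C-zero C-suc
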